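{- Let $L$ be a lattice of rank $n$ in a real $n$-dimensional vector space $V$, let $P\subset V$ be an $n$-dimensional convex polytope with vertices in $L$, and let $E(P)\in\mathbb{Q}[t]$ be its Ehrhart polynomial. Let $p$ be a prime and $k$ an integer with $1\le k\le n-1$, and define $$T(p,k)E(P)=\sum_{M\in\mathscr{L}_k}E(P_M),$$ where $\mathscr{L}_k$ and $E(P_M)$ are as in the context. Then for every $0\le l\le n$, $$c_l\bigl(T(p,k)E(P)\bigr)=\nu_{n,k,l}(p)\,c_l\bigl(E(P)\bigr)$$ (i.e. the ratio $c_l(T(p,k)E(P))/c_l(E(P))$ equals $\nu_{n,k,l}(p)$, independently of $P$). Moreover $$\nu_{n,k,l}(p)/\nu_{n,n-k,n-l}(p)=p^{k+l-n},$$ and for each triple $(n,k,l)$ there is a polynomial $\Phi_{n,k,l}(t)\in\mathbb{Z}[t]$ with positive coefficients, independent of $p$, such that $\Phi_{n,k,l}(p)=\nu_{n,k,l}(p)$ for every prime $p$.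
   Context: For a lattice $N\subset V$ of rank $n$ and an $n$-dimensional polytope $Q$ with vertices in $N$, the Ehrhart polynomial is the unique polynomial $E(Q)\in\mathbb{Q}[t]$ with $E(Q)(t)=\#(tQ\cap N)$ for all integers $t\ge0$. For $f\in\mathbb{Q}[t]$, $c_l(f)$ denotes the coefficient of $t^l$. Let $p^{ -1}L$ be the lattice $\{x: px\in L\}$, so $p^{ -1}L/L\cong\mathbb{F}_p^n$. $\mathscr{L}_k$ is the set of lattices $M$ with $L\subsetneq M\subsetneq p^{ -1}L$ such that the image $\overline M=M/L\subset p^{ -1}L/L\cong\mathbb{F}_p^n$ has dimension $k$. For $M\in\mathscr{L}_k$, $P_M$ denotes $P$ regarded as a lattice polytope with respect to $M$, so $E(P_M)(t)=\#(tP\cap M)$. For $0\le l\le n$, fix an $l$-dimensional subspace $U\subset\mathbb{F}_p^n$ and set $\nu_{n,k,l}(p)=\sum_{W}p^{\dim(W\cap U)}$, the sum over all $k$-dimensional subspaces $W\subset\mathbb{F}_p^n$ (this is independent of the choice of $U$). -}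

module Defs where

open import Data.Nat as ℕ using (ℕ; zero; suc; NonZero; _^_)
open import Data.Nat.DivMod using (_mod_)
open import Data.Fin using (Fin; toℕ)
open import Data.Integer using (ℤ; +_)
open import Data.Rational as ℚ using (ℚ; 0ℚ; 1ℚ; _/_)
open import Data.Vec as Vec using (Vec; []; _∷_; zipWith; replicate)
import Data.Vec.Relation.Unary.All as VAll
open import Data.List as List using (List; length)
open import Data.Nat.ListAction using () renaming (sum to sumℕ)
open import Data.List.Relation.Unary.All using (All)
open import Data.List.Relation.Unary.Any using (Any)
open import Data.List.Relation.Unary.AllPairs using (AllPairs)
open import Data.List.Relation.Unary.Unique.Propositional using (Unique)
open import Data.List.Relation.Binary.Pointwise using (Pointwise)
open import Data.List.Membership.Propositional using (_∈_)
open import Data.Product using (Σ; _×_)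
open import Relation.Binary.PropositionalEquality using (_≡_)
open import Relation.Nullary using (¬_)

_⇔_ : Set → Set → Set
A ⇔ B = (A → B) × (B → A)

HasSize : ∀ {n} → (Vec ℚ n → Set) → ℕ → Set
HasSize {n} S m =
  Σ (List (Vec ℚ n)) λ xs → Unique xs × (∀ x → (x ∈ xs) ⇔ S x) × length xs ≡ m

-- Rational vectors.  Coordinates are chosen so that the lattice L is ℤⁿ.
-- All points that are ever counted lie in p⁻¹L ⊂ ℚⁿ.

ℤtoℚ : ℤ → ℚ
ℤtoℚ z = z / 1

ℕtoℚ : ℕ → ℚ
ℕtoℚ k = (+ k) / 1

_+ᵥ_ : ∀ {n} → Vec ℚ n → Vec ℚ n → Vec ℚ n
_+ᵥ_ = zipWith ℚ._+_

_·ᵥ_ : ∀ {n} → ℚ → Vec ℚ n → Vec ℚ n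
c ·ᵥ v = Vec.map (c ℚ.*_) v

combo : ∀ {n m} → Vec ℚ m → Vec (Vec ℚ n) m → Vec ℚ n
combo {n} []       []       = replicate n 0ℚ
combo     (c ∷ cs) (v ∷ vs) = (c ·ᵥ v) +ᵥ combo cs vs

sumℚ : ∀ {m} → Vec ℚ m → ℚ
sumℚ = Vec.foldr _ ℚ._+_ 0ℚ

ℤvec : ∀ {n} → Vec ℤ n → Vec ℚ n
ℤvec = Vec.map ℤtoℚ

InL : ∀ {n} → Vec ℚ n → Set
InL {n} x = Σ (Vec ℤ n) λ y → x ≡ ℤvec y

-- Polytopes: P = conv(v₁,…,v_m) with all vᵢ ∈ L.

InDilate : ∀ {n m} → Vec (Vec ℤ n) m → ℕ → Vec ℚ n → Set
InDilate {n} {m} vs t x =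
  Σ (Vec ℚ m) λ lam →
    VAll.All (0ℚ ℚ.≤_) lam × sumℚ lam ≡ ℕtoℚ t × combo lam (Vec.map ℤvec vs) ≡ x

-- P is n-dimensional: its affine hull is all of V
-- (every point is an affine combination of the vertices).
FullDim : ∀ {n m} → Vec (Vec ℤ n) m → Set
FullDim {n} {m} vs =
  ∀ (x : Vec ℚ n) → Σ (Vec ℚ m) λ mu → sumℚ mu ≡ 1ℚ × combo mu (Vec.map ℤvec vs) ≡ x

-- Polynomials in ℚ[t] as coefficient lists (constant term first).

Poly : Set
Poly = List ℚ

eval : Poly → ℚ → ℚ
eval List.[]       t = 0ℚ
eval (c List.∷ cs) t = c ℚ.+ t ℚ.* eval cs t

coeff : Poly → ℕ → ℚ
coeff List.[]       l       = 0ℚ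
coeff (c List.∷ cs) zero    = c
coeff (c List.∷ cs) (suc l) = coeff cs l

-- Polynomials in ℤ[t] with nonnegative coefficients, evaluated at a natural
evalℕ : List ℕ → ℕ → ℕ
evalℕ List.[]       x = 0
evalℕ (c List.∷ cs) x = c ℕ.+ x ℕ.* evalℕ cs x

module _ (p : ℕ) .{{_ : NonZero p}} where

  Fp : Set
  Fp = Fin p

  0ₚ : Fp
  0ₚ = 0 mod p

  _+ₚ_ : Fp → Fp → Fp
  a +ₚ b = (toℕ a ℕ.+ toℕ b) mod p

  _*ₚ_ : Fp → Fp → Fp
  a *ₚ b = (toℕ a ℕ.* toℕ b) mod p

  Fpⁿ : ℕ → Set
  Fpⁿ n = Vec Fp n

  lincomb : ∀ {n d} → Vec Fp d → Vec (Fpⁿ n) d → Fpⁿ n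
  lincomb {n} []       []       = replicate n 0ₚ
  lincomb     (c ∷ cs) (w ∷ ws) = zipWith _+ₚ_ (Vec.map (c *ₚ_) w) (lincomb cs ws)

  LinIndep : ∀ {n d} → Vec (Fpⁿ n) d → Set
  LinIndep {n} {d} ws = ∀ (cs : Vec Fp d) → lincomb cs ws ≡ replicate n 0ₚ → cs ≡ replicate d 0ₚ

  -- Subsets of 𝔽ₚⁿ are predicates.  W is a subspace of dimension d:
  -- it has a basis of d vectors (linearly independent, spanning exactly W).
  HasDim : ∀ {n} → (Fpⁿ n → Set) → ℕ → Set
  HasDim {n} W d =
    Σ (Vec (Fpⁿ n) d) λ ws →
      LinIndep ws × (∀ x → W x ⇔ Σ (Vec Fp d) λ cs → lincomb cs ws ≡ x)

  SameSet : ∀ {n} → (Fpⁿ n → Set) → (Fpⁿ n → Set) → Set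
  SameSet W W' = ∀ x → W x ⇔ W' x

  _∩_ : ∀ {n} → (Fpⁿ n → Set) → (Fpⁿ n → Set) → (Fpⁿ n → Set)
  (W ∩ U) x = W x × U x

  -- ws lists every k-dimensional subspace of 𝔽ₚⁿ exactly once (up to
  -- extensional equality of subsets)
  EnumSubspaces : (n k : ℕ) → List (Fpⁿ n → Set) → Set₁
  EnumSubspaces n k ws =
    All (λ W → HasDim W k) ws
    × (∀ W → HasDim W k → Any (SameSet W) ws)
    × AllPairs (λ W W' → ¬ SameSet W W') ws

  -- ν = ν_{n,k,l}(p) = Σ_{W k-dim} p^{dim (W ∩ U)}   (U the fixed subspace)
  NuValue : (n k : ℕ) → (Fpⁿ n → Set) → ℕ → Set₁
  NuValue n k U ν =
    Σ (List (Fpⁿ n → Set)) λ ws → EnumSubspaces n k ws ×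
      Σ (List ℕ) λ ds → Pointwise (λ W d → HasDim (W ∩ U) d) ws ds
        × ν ≡ sumℕ (List.map (p ^_) ds)

  -- The lattice M with L ⊆ M ⊆ p⁻¹L whose image M/L ⊂ p⁻¹L/L ≅ 𝔽ₚⁿ is W:
  -- M = { y + w/p : y ∈ ℤⁿ, w ∈ W } (w lifted to {0,…,p-1}ⁿ).
  InLattice : ∀ {n} → (Fpⁿ n → Set) → Vec ℚ n → Set
  InLattice {n} W x =
    Σ (Fpⁿ n) λ w → W w × Σ (Vec ℤ n) λ y →
      x ≡ ℤvec y +ᵥ Vec.map (λ i → (+ toℕ i) / p) w

  -- s = Σ_{M ∈ 𝓛_k} #(tP ∩ M), i.e. the value at t of T(p,k)E(P)
  TValue : ∀ {n m} → (k : ℕ) → Vec (Vec ℤ n) m → ℕ → ℕ → Set₁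
  TValue {n} k vs t s =
    Σ (List (Fpⁿ n → Set)) λ ws → EnumSubspaces n k ws ×
      Σ (List ℕ) λ cs →
        Pointwise (λ W c → HasSize (λ x → InDilate vs t x × InLattice W x) c) ws cs
        × s ≡ sumℕ cs

IsEhrhart : ∀ {n m} → Vec (Vec ℤ n) m → Poly → Set
IsEhrhart vs E = ∀ (t : ℕ) →
  Σ ℕ λ c → HasSize (λ x → InDilate vs t x × InL x) c × eval E (ℕtoℚ t) ≡ ℕtoℚ c

IsTpkE : ∀ {n m} (p : ℕ) .{{_ : NonZero p}} → ℕ → Vec (Vec ℤ n) m → Poly → Set₁
IsTpkE p k vs F = ∀ (t : ℕ) →
  Σ ℕ λ s → TValue p k vs t s × eval F (ℕtoℚ t) ≡ ℕtoℚ s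

{-# OPTIONS --safe #-}

-- For a k-dimensional subspace W of 𝔽ₚⁿ = p⁻¹L/L with lattice M_W, the map x ↦ p x
-- identifies tP ∩ M_W with the points z of ptP ∩ L whose reduction mod p lies in W.
-- Summing over W and exchanging the sums, each z is counted once for every k-subspace
-- through z mod p: there are a = [n-1, k-1]_p of them if z ≢ 0 and a + b, with
-- b = p^k [n-1, k]_p, if z ≡ 0 (mod p); the reduction of z is 0 exactly when z / p ∈ L.
-- Hence T(p,k)E(P)(t) = a E(P)(pt) + b E(P)(t), and c_l(T(p,k)E(P)) = (p^l a + b) c_l(E(P)).
-- The same double count over the p^l points of U gives ν_{n,k,l}(p) = p^l a + b. The
-- numbers of subspaces through a vector are found by counting independent families,
-- which produces the Gaussian binomials; their symmetry [n, k] = [n, n-k] gives the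
-- duality, and they are polynomials in p with natural coefficients.

module Submission where

open import Defs

open import Level using (Level)
open import Data.Empty using (⊥-elim)
open import Data.Unit using (⊤; tt)
open import Data.Product using (Σ; _,_; _×_; proj₁; proj₂)
open import Function.Bundles using (mk⇔)
open import Relation.Binary.PropositionalEquality
  using (_≡_; refl; sym; trans; cong; cong₂; subst; module ≡-Reasoning)
open import Relation.Nullary using (¬_; Dec; yes; no; ¬?)
open import Relation.Nullary.Decidable using (_×-dec_)

open import Data.Nat as ℕ
  using (ℕ; zero; suc; NonZero; _+_; _*_; _^_; _∸_; _≤_; _<_; z≤n; s≤s)
import Data.Nat.Properties as ℕₚ
open import Data.Nat.DivMod using (_%_; _mod_; m<n⇒m%n≡m; %-distribˡ-+; %-distribˡ-*; [m+kn]%n≡m%n)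
open import Data.Nat.Primality using (Prime; prime⇒nonTrivial)
open import Data.Nat.Coprimality using (prime⇒coprime; coprime-Bézout)
import Data.Nat.Coprimality as Coprime
open import Data.Nat.GCD using (module Bézout)
open import Data.Nat.ListAction using () renaming (sum to sumℕ)
open import Data.Nat.Solver using (module +-*-Solver)
open import Algebra.Properties.CommutativeSemigroup ℕₚ.+-commutativeSemigroup
  using () renaming (interchange to +-interchange)
open import Algebra.Properties.CommutativeSemigroup ℕₚ.*-commutativeSemigroup
  using () renaming (x∙yz≈y∙xz to *-left-comm)

open import Data.Fin using (Fin; toℕ; fromℕ<)
import Data.Fin.Properties as Finₚ

open import Data.List as List using (List; []; _∷_; length; map; filter; cartesianProductWith)
import Data.List.Properties as Listₚ
open import Data.List.Membership.Propositional using (_∈_; lose)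
open import Data.List.Membership.Propositional.Properties
  using (∈-cartesianProductWith⁺; ∈-map⁺; ∈-map⁻; ∈-filter⁺; ∈-filter⁻; ∈-allFin)
open import Data.List.Membership.Propositional.Properties.WithK using (unique∧set⇒bag)
open import Data.List.Relation.Binary.BagAndSetEquality using (∼bag⇒↭)
open import Data.List.Relation.Binary.Permutation.Propositional.Properties using (↭-length)
open import Data.List.Relation.Binary.Pointwise using (Pointwise; []; _∷_)
open import Data.List.Relation.Unary.All as All using (All)
open import Data.List.Relation.Unary.AllPairs as AllPairs using (AllPairs)
open import Data.List.Relation.Unary.Any as Any using (Any; here; there; any?)
open import Data.List.Relation.Unary.Unique.Propositional using (Unique)
import Data.List.Relation.Unary.Unique.Propositional.Properties as Uniqueₚ

open import Data.Vec as Vec using (Vec; []; _∷_; _++_)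
import Data.Vec.Properties as Vecₚ
import Data.Vec.Relation.Unary.All as VecAll

open import Data.Integer as ℤ using (ℤ; ∣_∣)
import Data.Integer
import Data.Integer.Properties as ℤₚ
import Data.Integer.Solver as ℤSolver
import Data.Integer.GCD as ℤGCD
open import Data.Integer.DivMod using (_%ℕ_; _/ℕ_; a≡a%ℕn+[a/ℕn]*n; n%ℕd<d)
open import Data.Rational as ℚ using (ℚ; 0ℚ; 1ℚ; _/_; ↥_)
import Data.Rational.Properties as ℚₚ
import Data.Rational.Solver as ℚSolver
open import Data.Rational.Unnormalised as ℚᵘ using (mkℚᵘ; *≡*)
import Data.Rational.Unnormalised.Properties as ℚᵘₚ

private variable
  ℓ ℓ′ : Level
  A : Set ℓ
  B : Set ℓ′
  d e i j k n : ℕ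

∑ : (A → ℕ) → List A → ℕ
∑ f []       = 0
∑ f (x ∷ xs) = f x + ∑ f xs

indicator : {P : Set} → Dec P → ℕ
indicator (yes _) = 1
indicator (no _)  = 0

count : {P : A → Set} → (∀ x → Dec (P x)) → List A → ℕ
count P? = ∑ (λ x → indicator (P? x))

module _ {P : A → Set} (P? : ∀ x → Dec (P x)) where

  count≡length-filter : ∀ xs → count P? xs ≡ length (filter P? xs)
  count≡length-filter []       = refl
  count≡length-filter (x ∷ xs) with P? x
  ... | yes _ = cong suc (count≡length-filter xs)
  ... | no _  = count≡length-filter xs

  count-all : ∀ xs → (∀ x → x ∈ xs → P x) → count P? xs ≡ length xs
  count-all []       _ = refl
  count-all (x ∷ xs) h with P? x
  ... | yes _  = cong suc (count-all xs (λ y y∈ → h y (there y∈)))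
  ... | no ¬px = ⊥-elim (¬px (h x (here refl)))

  count-none : ∀ xs → (∀ x → x ∈ xs → ¬ P x) → count P? xs ≡ 0
  count-none []       _ = refl
  count-none (x ∷ xs) h with P? x
  ... | yes px = ⊥-elim (h x (here refl) px)
  ... | no _   = count-none xs (λ y y∈ → h y (there y∈))

  count≡0⇒∉ : ∀ xs → count P? xs ≡ 0 → ∀ {x} → x ∈ xs → ¬ P x
  count≡0⇒∉ (y ∷ xs) e x∈ px with P? y | x∈
  ... | no ¬py | here refl = ¬py px
  ... | no _   | there x∈′ = count≡0⇒∉ xs e x∈′ px

  count≡1 : ∀ xs → Any P xs → AllPairs (λ u v → ¬ (P u × P v)) xs → count P? xs ≡ 1
  count≡1 (x ∷ xs) (here px) (h AllPairs.∷ _) with P? x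
  ... | no ¬px = ⊥-elim (¬px px)
  ... | yes _  = cong suc (count-none xs λ y y∈ py → All.lookup h y∈ (px , py))
  count≡1 (x ∷ xs) (there any) (h AllPairs.∷ hs) with P? x
  ... | yes px = let ¬both , py = All.lookupAny h any in ⊥-elim (¬both (px , py))
  ... | no _   = count≡1 xs any hs

indicator-cong : {P Q : Set} (P? : Dec P) (Q? : Dec Q) → P ⇔ Q → indicator P? ≡ indicator Q?
indicator-cong (yes _)  (yes _)  _       = refl
indicator-cong (yes p)  (no ¬q)  (f , _) = ⊥-elim (¬q (f p))
indicator-cong (no ¬p)  (yes q)  (_ , g) = ⊥-elim (¬p (g q))
indicator-cong (no _)   (no _)   _       = refl

indicator-× : {P Q : Set} (P? : Dec P) (Q? : Dec Q) → indicator P? * indicator Q? ≡ indicator (P? ×-dec Q?)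
indicator-× (yes _) (yes _) = refl
indicator-× (yes _) (no _)  = refl
indicator-× (no _)  _       = refl

∑-cong : (f g : A → ℕ) (xs : List A) → (∀ x → x ∈ xs → f x ≡ g x) → ∑ f xs ≡ ∑ g xs
∑-cong f g []       _ = refl
∑-cong f g (x ∷ xs) h = cong₂ _+_ (h x (here refl)) (∑-cong f g xs (λ y y∈ → h y (there y∈)))

count-cong : {P Q : A → Set} (P? : ∀ x → Dec (P x)) (Q? : ∀ x → Dec (Q x)) (xs : List A) →
             (∀ x → x ∈ xs → P x ⇔ Q x) → count P? xs ≡ count Q? xs
count-cong P? Q? xs h = ∑-cong _ _ xs (λ x x∈ → indicator-cong (P? x) (Q? x) (h x x∈))

module _ {S W : A → Set} (S? : ∀ x → Dec (S x)) (W? : ∀ x → Dec (W x)) where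

  count-split : ∀ xs → (∀ x → S x → W x) → count W? xs ≡ count S? xs + count (λ x → W? x ×-dec ¬? (S? x)) xs
  count-split []       _   = refl
  count-split (x ∷ xs) S⊆W with S? x | W? x
  ... | yes _  | yes _  = cong suc (count-split xs S⊆W)
  ... | yes s  | no ¬w  = ⊥-elim (¬w (S⊆W x s))
  ... | no _   | yes _  = trans (cong suc (count-split xs S⊆W)) (sym (ℕₚ.+-suc _ _))
  ... | no _   | no _   = count-split xs S⊆W

  ⊆∧count≡⇒⊇ : ∀ xs → (∀ x → S x → W x) → count S? xs ≡ count W? xs → ∀ {x} → x ∈ xs → W x → S x
  ⊆∧count≡⇒⊇ xs S⊆W same {x} x∈ w with S? x
  ... | yes s  = s
  ... | no ¬s  = ⊥-elim (count≡0⇒∉ (λ x → W? x ×-dec ¬? (S? x)) xs rest≡0 x∈ (w , ¬s))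
    where
    rest≡0 : count (λ x → W? x ×-dec ¬? (S? x)) xs ≡ 0
    rest≡0 = sym (ℕₚ.+-cancelˡ-≡ (count S? xs) 0 _
               (trans (ℕₚ.+-identityʳ _) (trans same (count-split xs S⊆W))))

∑-+ : (f g : A → ℕ) (xs : List A) → ∑ (λ x → f x + g x) xs ≡ ∑ f xs + ∑ g xs
∑-+ f g []       = refl
∑-+ f g (x ∷ xs) = trans (cong (f x + g x +_) (∑-+ f g xs)) (+-interchange (f x) (g x) _ _)

∑-*ˡ : (c : ℕ) (f : A → ℕ) (xs : List A) → ∑ (λ x → c * f x) xs ≡ c * ∑ f xs
∑-*ˡ c f []       = sym (ℕₚ.*-zeroʳ c)
∑-*ˡ c f (x ∷ xs) = trans (cong (c * f x +_) (∑-*ˡ c f xs)) (sym (ℕₚ.*-distribˡ-+ c (f x) _))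

∑-*ʳ : (c : ℕ) (f : A → ℕ) (xs : List A) → ∑ (λ x → f x * c) xs ≡ c * ∑ f xs
∑-*ʳ c f xs = trans (∑-cong _ _ xs (λ x _ → ℕₚ.*-comm (f x) c)) (∑-*ˡ c f xs)

∑-const : (c : ℕ) (xs : List A) → ∑ (λ _ → c) xs ≡ length xs * c
∑-const c []       = refl
∑-const c (x ∷ xs) = cong (c +_) (∑-const c xs)

∑-++ : (f : A → ℕ) (xs ys : List A) → ∑ f (xs List.++ ys) ≡ ∑ f xs + ∑ f ys
∑-++ f []       ys = refl
∑-++ f (x ∷ xs) ys = trans (cong (f x +_) (∑-++ f xs ys)) (sym (ℕₚ.+-assoc (f x) _ _))

∑-map : (f : B → ℕ) (g : A → B) (xs : List A) → ∑ f (map g xs) ≡ ∑ (λ x → f (g x)) xs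
∑-map f g []       = refl
∑-map f g (x ∷ xs) = cong (f (g x) +_) (∑-map f g xs)

∑-swap : (f : A → B → ℕ) (xs : List A) (ys : List B) →
         ∑ (λ x → ∑ (f x) ys) xs ≡ ∑ (λ y → ∑ (λ x → f x y) xs) ys
∑-swap f []       ys = sym (trans (∑-const 0 ys) (ℕₚ.*-zeroʳ (length ys)))
∑-swap f (x ∷ xs) ys = trans (cong (∑ (f x) ys +_) (∑-swap f xs ys)) (sym (∑-+ (f x) _ ys))

Unique∧same-elements⇒length≡ : {xs ys : List A} → Unique xs → Unique ys →
                               (∀ x → (x ∈ xs) ⇔ (x ∈ ys)) → length xs ≡ length ys
Unique∧same-elements⇒length≡ uxs uys same =
  ↭-length (∼bag⇒↭ (unique∧set⇒bag uxs uys (λ {x} → mk⇔ (proj₁ (same x)) (proj₂ (same x)))))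

module _ {P : A → Set} where

  Any-toList : {Q : A → Set ℓ′} {xs : List A} (pxs : All P xs) → Any Q xs → Any (λ y → Q (proj₁ y)) (All.toList pxs)
  Any-toList (_ All.∷ _)   (here qx)  = here qx
  Any-toList (_ All.∷ pxs) (there qx) = there (Any-toList pxs qx)

  AllPairs-toList : {R : A → A → Set ℓ′} {xs : List A} (pxs : All P xs) →
                    AllPairs R xs → AllPairs (λ y z → R (proj₁ y) (proj₁ z)) (All.toList pxs)
  AllPairs-toList All.[]         AllPairs.[]         = AllPairs.[]
  AllPairs-toList (_ All.∷ pxs) (rs AllPairs.∷ rss) = lift pxs rs AllPairs.∷ AllPairs-toList pxs rss
    where
    lift : ∀ {R′ : A → Set ℓ′} {ys} (pys : All P ys) → All R′ ys → All (λ z → R′ (proj₁ z)) (All.toList pys)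
    lift All.[]         All.[]         = All.[]
    lift (_ All.∷ pys) (r All.∷ rs′) = r All.∷ lift pys rs′

vectors : List A → (d : ℕ) → List (Vec A d)
vectors xs zero    = [] ∷ []
vectors xs (suc d) = cartesianProductWith _∷_ xs (vectors xs d)

∈-vectors : {xs : List A} → (∀ x → x ∈ xs) → ∀ {d} (v : Vec A d) → v ∈ vectors xs d
∈-vectors all []      = here refl
∈-vectors all (x ∷ v) = ∈-cartesianProductWith⁺ _∷_ (all x) (∈-vectors all v)

vectors-unique : {xs : List A} → Unique xs → ∀ d → Unique (vectors xs d)
vectors-unique u zero    = All.[] AllPairs.∷ AllPairs.[]
vectors-unique u (suc d) = Uniqueₚ.cartesianProductWith⁺ _∷_ Vecₚ.∷-injective u (vectors-unique u d)

∑-vectors-suc : (f : Vec A (suc d) → ℕ) (xs : List A) →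
                ∑ f (vectors xs (suc d)) ≡ ∑ (λ x → ∑ (λ v → f (x ∷ v)) (vectors xs d)) xs
∑-vectors-suc {d = d} f xs = ∑-cartesianProduct xs
  where
  ∑-cartesianProduct : ∀ ys → ∑ f (cartesianProductWith _∷_ ys (vectors xs d)) ≡ ∑ (λ y → ∑ (λ v → f (y ∷ v)) (vectors xs d)) ys
  ∑-cartesianProduct []       = refl
  ∑-cartesianProduct (y ∷ ys) = trans (∑-++ f (map (y ∷_) (vectors xs d)) _) (cong₂ _+_ (∑-map f (y ∷_) (vectors xs d)) (∑-cartesianProduct ys))

length-vectors : (xs : List A) (d : ℕ) → length (vectors xs d) ≡ length xs ^ d
length-vectors xs zero    = refl
length-vectors xs (suc d) = begin
  length (vectors xs (suc d))                       ≡⟨ length≡∑1 (vectors xs (suc d)) ⟩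
  ∑ (λ _ → 1) (vectors xs (suc d))                  ≡⟨ ∑-vectors-suc (λ _ → 1) xs ⟩
  ∑ (λ _ → ∑ (λ _ → 1) (vectors xs d)) xs           ≡⟨ ∑-const _ xs ⟩
  length xs * ∑ (λ _ → 1) (vectors xs d)            ≡⟨ cong (length xs *_) (sym (length≡∑1 (vectors xs d))) ⟩
  length xs * length (vectors xs d)                 ≡⟨ cong (length xs *_) (length-vectors xs d) ⟩
  length xs * length xs ^ d                         ∎
  where
  open ≡-Reasoning
  length≡∑1 : (ys : List B) → length ys ≡ ∑ (λ _ → 1) ys
  length≡∑1 ys = sym (trans (∑-const 1 ys) (ℕₚ.*-identityʳ _))

module Modular (p : ℕ) .{{_ : NonZero p}} where

  𝔽 : Set
  𝔽 = Fp p

  infixl 6 _+ᶠ_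
  infixl 7 _*ᶠ_

  _+ᶠ_ _*ᶠ_ : 𝔽 → 𝔽 → 𝔽
  _+ᶠ_ = _+ₚ_ p
  _*ᶠ_ = _*ₚ_ p

  [_] : ℕ → 𝔽
  [ m ] = m mod p

  0ᶠ 1ᶠ -1ᶠ : 𝔽
  0ᶠ  = 0ₚ p
  1ᶠ  = [ 1 ]
  -1ᶠ = [ ℕ.pred p ]

  toℕ-[] : ∀ m → toℕ [ m ] ≡ m % p
  toℕ-[] m = Finₚ.toℕ-fromℕ< _

  []-cong : ∀ {m n} → m % p ≡ n % p → [ m ] ≡ [ n ]
  []-cong {m} {n} eq = Finₚ.toℕ-injective (trans (toℕ-[] m) (trans eq (sym (toℕ-[] n))))

  [toℕ] : ∀ a → [ toℕ a ] ≡ a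
  [toℕ] a = Finₚ.toℕ-injective (trans (toℕ-[] (toℕ a)) (m<n⇒m%n≡m (Finₚ.toℕ<n a)))

  []-+ : ∀ m n → [ m ] +ᶠ [ n ] ≡ [ m + n ]
  []-+ m n = []-cong (begin
    (toℕ [ m ] + toℕ [ n ]) % p ≡⟨ cong₂ (λ u v → (u + v) % p) (toℕ-[] m) (toℕ-[] n) ⟩
    (m % p + n % p) % p         ≡⟨ sym (%-distribˡ-+ m n p) ⟩
    (m + n) % p                 ∎)
    where open ≡-Reasoning

  []-* : ∀ m n → [ m ] *ᶠ [ n ] ≡ [ m * n ]
  []-* m n = []-cong (begin
    (toℕ [ m ] * toℕ [ n ]) % p ≡⟨ cong₂ (λ u v → (u * v) % p) (toℕ-[] m) (toℕ-[] n) ⟩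
    (m % p * (n % p)) % p       ≡⟨ sym (%-distribˡ-* m n p) ⟩
    (m * n) % p                 ∎)
    where open ≡-Reasoning

  []-+kp : ∀ m k → [ m + k * p ] ≡ [ m ]
  []-+kp m k = []-cong ([m+kn]%n≡m%n m k p)

  +ᶠ-comm : ∀ a b → a +ᶠ b ≡ b +ᶠ a
  +ᶠ-comm a b = cong [_] (ℕₚ.+-comm (toℕ a) (toℕ b))

  *ᶠ-comm : ∀ a b → a *ᶠ b ≡ b *ᶠ a
  *ᶠ-comm a b = cong [_] (ℕₚ.*-comm (toℕ a) (toℕ b))

  +ᶠ-assoc : ∀ a b c → a +ᶠ b +ᶠ c ≡ a +ᶠ (b +ᶠ c)
  +ᶠ-assoc a b c = begin
    [ x + y ] +ᶠ c       ≡⟨ cong ([ x + y ] +ᶠ_) (sym ([toℕ] c)) ⟩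
    [ x + y ] +ᶠ [ z ]   ≡⟨ []-+ (x + y) z ⟩
    [ x + y + z ]        ≡⟨ cong [_] (ℕₚ.+-assoc x y z) ⟩
    [ x + (y + z) ]      ≡⟨ sym ([]-+ x (y + z)) ⟩
    [ x ] +ᶠ [ y + z ]   ≡⟨ cong (_+ᶠ [ y + z ]) ([toℕ] a) ⟩
    a +ᶠ (b +ᶠ c)        ∎
    where
    open ≡-Reasoning
    x y z : ℕ
    x = toℕ a
    y = toℕ b
    z = toℕ c

  *ᶠ-assoc : ∀ a b c → a *ᶠ b *ᶠ c ≡ a *ᶠ (b *ᶠ c)
  *ᶠ-assoc a b c = begin
    [ x * y ] *ᶠ c       ≡⟨ cong ([ x * y ] *ᶠ_) (sym ([toℕ] c)) ⟩
    [ x * y ] *ᶠ [ z ]   ≡⟨ []-* (x * y) z ⟩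
    [ x * y * z ]        ≡⟨ cong [_] (ℕₚ.*-assoc x y z) ⟩
    [ x * (y * z) ]      ≡⟨ sym ([]-* x (y * z)) ⟩
    [ x ] *ᶠ [ y * z ]   ≡⟨ cong (_*ᶠ [ y * z ]) ([toℕ] a) ⟩
    a *ᶠ (b *ᶠ c)        ∎
    where
    open ≡-Reasoning
    x y z : ℕ
    x = toℕ a
    y = toℕ b
    z = toℕ c

  *ᶠ-distribˡ-+ᶠ : ∀ a b c → a *ᶠ (b +ᶠ c) ≡ a *ᶠ b +ᶠ a *ᶠ c
  *ᶠ-distribˡ-+ᶠ a b c = begin
    a *ᶠ [ y + z ]              ≡⟨ cong (_*ᶠ [ y + z ]) (sym ([toℕ] a)) ⟩
    [ x ] *ᶠ [ y + z ]          ≡⟨ []-* x (y + z) ⟩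
    [ x * (y + z) ]             ≡⟨ cong [_] (ℕₚ.*-distribˡ-+ x y z) ⟩
    [ x * y + x * z ]           ≡⟨ sym ([]-+ (x * y) (x * z)) ⟩
    [ x * y ] +ᶠ [ x * z ]      ∎
    where
    open ≡-Reasoning
    x y z : ℕ
    x = toℕ a
    y = toℕ b
    z = toℕ c

  *ᶠ-distribʳ-+ᶠ : ∀ a b c → (b +ᶠ c) *ᶠ a ≡ b *ᶠ a +ᶠ c *ᶠ a
  *ᶠ-distribʳ-+ᶠ a b c = begin
    (b +ᶠ c) *ᶠ a          ≡⟨ *ᶠ-comm (b +ᶠ c) a ⟩
    a *ᶠ (b +ᶠ c)          ≡⟨ *ᶠ-distribˡ-+ᶠ a b c ⟩
    a *ᶠ b +ᶠ a *ᶠ c       ≡⟨ cong₂ _+ᶠ_ (*ᶠ-comm a b) (*ᶠ-comm a c) ⟩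
    b *ᶠ a +ᶠ c *ᶠ a       ∎
    where open ≡-Reasoning

  +ᶠ-identityˡ : ∀ a → 0ᶠ +ᶠ a ≡ a
  +ᶠ-identityˡ a = trans (cong (0ᶠ +ᶠ_) (sym ([toℕ] a))) (trans ([]-+ 0 (toℕ a)) ([toℕ] a))

  +ᶠ-identityʳ : ∀ a → a +ᶠ 0ᶠ ≡ a
  +ᶠ-identityʳ a = trans (+ᶠ-comm a 0ᶠ) (+ᶠ-identityˡ a)

  *ᶠ-identityˡ : ∀ a → 1ᶠ *ᶠ a ≡ a
  *ᶠ-identityˡ a = trans (cong (1ᶠ *ᶠ_) (sym ([toℕ] a))) (trans ([]-* 1 (toℕ a)) (trans (cong [_] (ℕₚ.*-identityˡ (toℕ a))) ([toℕ] a)))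

  *ᶠ-identityʳ : ∀ a → a *ᶠ 1ᶠ ≡ a
  *ᶠ-identityʳ a = trans (*ᶠ-comm a 1ᶠ) (*ᶠ-identityˡ a)

  *ᶠ-zeroˡ : ∀ a → 0ᶠ *ᶠ a ≡ 0ᶠ
  *ᶠ-zeroˡ a = trans (cong (0ᶠ *ᶠ_) (sym ([toℕ] a))) ([]-* 0 (toℕ a))

  *ᶠ-zeroʳ : ∀ a → a *ᶠ 0ᶠ ≡ 0ᶠ
  *ᶠ-zeroʳ a = trans (*ᶠ-comm a 0ᶠ) (*ᶠ-zeroˡ a)

  +ᶠ-inverseʳ : ∀ a → a +ᶠ -1ᶠ *ᶠ a ≡ 0ᶠ
  +ᶠ-inverseʳ a = begin
    a +ᶠ -1ᶠ *ᶠ a                 ≡⟨ cong (λ x → x +ᶠ -1ᶠ *ᶠ x) (sym ([toℕ] a)) ⟩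
    [ x ] +ᶠ [ ℕ.pred p ] *ᶠ [ x ] ≡⟨ cong ([ x ] +ᶠ_) ([]-* (ℕ.pred p) x) ⟩
    [ x ] +ᶠ [ ℕ.pred p * x ]     ≡⟨ []-+ x (ℕ.pred p * x) ⟩
    [ x + ℕ.pred p * x ]          ≡⟨ cong [_] (cong (_* x) (ℕₚ.suc-pred p)) ⟩
    [ p * x ]                     ≡⟨ cong [_] (ℕₚ.*-comm p x) ⟩
    [ 0 + x * p ]                 ≡⟨ []-+kp 0 x ⟩
    0ᶠ                            ∎
    where
    open ≡-Reasoning
    x : ℕ
    x = toℕ a

  +ᶠ-cancelˡ : ∀ a {b c} → a +ᶠ b ≡ a +ᶠ c → b ≡ c
  +ᶠ-cancelˡ a {b} {c} eq = begin
    b                          ≡⟨ sym (+ᶠ-identityˡ b) ⟩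
    0ᶠ +ᶠ b                    ≡⟨ cong (_+ᶠ b) (sym -a+a≡0) ⟩
    -1ᶠ *ᶠ a +ᶠ a +ᶠ b         ≡⟨ +ᶠ-assoc (-1ᶠ *ᶠ a) a b ⟩
    -1ᶠ *ᶠ a +ᶠ (a +ᶠ b)       ≡⟨ cong (-1ᶠ *ᶠ a +ᶠ_) eq ⟩
    -1ᶠ *ᶠ a +ᶠ (a +ᶠ c)       ≡⟨ sym (+ᶠ-assoc (-1ᶠ *ᶠ a) a c) ⟩
    -1ᶠ *ᶠ a +ᶠ a +ᶠ c         ≡⟨ cong (_+ᶠ c) -a+a≡0 ⟩
    0ᶠ +ᶠ c                    ≡⟨ +ᶠ-identityˡ c ⟩
    c                          ∎
    where
    open ≡-Reasoning
    -a+a≡0 : -1ᶠ *ᶠ a +ᶠ a ≡ 0ᶠ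
    -a+a≡0 = trans (+ᶠ-comm (-1ᶠ *ᶠ a) a) (+ᶠ-inverseʳ a)

  -1ᶠ*-1ᶠ : -1ᶠ *ᶠ -1ᶠ ≡ 1ᶠ
  -1ᶠ*-1ᶠ = +ᶠ-cancelˡ -1ᶠ (begin
    -1ᶠ +ᶠ -1ᶠ *ᶠ -1ᶠ   ≡⟨ +ᶠ-inverseʳ -1ᶠ ⟩
    0ᶠ                   ≡⟨ sym (+ᶠ-inverseʳ 1ᶠ) ⟩
    1ᶠ +ᶠ -1ᶠ *ᶠ 1ᶠ      ≡⟨ cong (1ᶠ +ᶠ_) (*ᶠ-identityʳ -1ᶠ) ⟩
    1ᶠ +ᶠ -1ᶠ            ≡⟨ +ᶠ-comm 1ᶠ -1ᶠ ⟩
    -1ᶠ +ᶠ 1ᶠ            ∎)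
    where open ≡-Reasoning

  𝔽ⁿ : ℕ → Set
  𝔽ⁿ = Fpⁿ p

  infixl 6 _⊕_
  infixr 7 _⊙_

  _⊕_ : 𝔽ⁿ n → 𝔽ⁿ n → 𝔽ⁿ n
  _⊕_ = Vec.zipWith _+ᶠ_

  _⊙_ : 𝔽 → 𝔽ⁿ n → 𝔽ⁿ n
  c ⊙ v = Vec.map (c *ᶠ_) v

  𝟎 : ∀ n → 𝔽ⁿ n
  𝟎 n = Vec.replicate n 0ᶠ

  ⊕-comm : (u v : 𝔽ⁿ n) → u ⊕ v ≡ v ⊕ u
  ⊕-comm []      []      = refl
  ⊕-comm (a ∷ u) (b ∷ v) = cong₂ _∷_ (+ᶠ-comm a b) (⊕-comm u v)

  ⊕-assoc : (u v w : 𝔽ⁿ n) → u ⊕ v ⊕ w ≡ u ⊕ (v ⊕ w)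
  ⊕-assoc []      []      []      = refl
  ⊕-assoc (a ∷ u) (b ∷ v) (c ∷ w) = cong₂ _∷_ (+ᶠ-assoc a b c) (⊕-assoc u v w)

  ⊕-identityˡ : (v : 𝔽ⁿ n) → 𝟎 n ⊕ v ≡ v
  ⊕-identityˡ []      = refl
  ⊕-identityˡ (a ∷ v) = cong₂ _∷_ (+ᶠ-identityˡ a) (⊕-identityˡ v)

  ⊕-identityʳ : (v : 𝔽ⁿ n) → v ⊕ 𝟎 n ≡ v
  ⊕-identityʳ v = trans (⊕-comm v _) (⊕-identityˡ v)

  ⊕-inverseʳ : (v : 𝔽ⁿ n) → v ⊕ -1ᶠ ⊙ v ≡ 𝟎 n
  ⊕-inverseʳ []      = refl
  ⊕-inverseʳ (a ∷ v) = cong₂ _∷_ (+ᶠ-inverseʳ a) (⊕-inverseʳ v)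

  ⊕-interchange : (u v w x : 𝔽ⁿ n) → (u ⊕ v) ⊕ (w ⊕ x) ≡ (u ⊕ w) ⊕ (v ⊕ x)
  ⊕-interchange u v w x = begin
    (u ⊕ v) ⊕ (w ⊕ x)   ≡⟨ ⊕-assoc u v (w ⊕ x) ⟩
    u ⊕ (v ⊕ (w ⊕ x))   ≡⟨ cong (u ⊕_) (sym (⊕-assoc v w x)) ⟩
    u ⊕ (v ⊕ w ⊕ x)     ≡⟨ cong (λ y → u ⊕ (y ⊕ x)) (⊕-comm v w) ⟩
    u ⊕ (w ⊕ v ⊕ x)     ≡⟨ cong (u ⊕_) (⊕-assoc w v x) ⟩
    u ⊕ (w ⊕ (v ⊕ x))   ≡⟨ sym (⊕-assoc u w (v ⊕ x)) ⟩
    (u ⊕ w) ⊕ (v ⊕ x)   ∎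
    where open ≡-Reasoning

  ⊙-distribˡ-⊕ : ∀ c (u v : 𝔽ⁿ n) → c ⊙ (u ⊕ v) ≡ c ⊙ u ⊕ c ⊙ v
  ⊙-distribˡ-⊕ c []      []      = refl
  ⊙-distribˡ-⊕ c (a ∷ u) (b ∷ v) = cong₂ _∷_ (*ᶠ-distribˡ-+ᶠ c a b) (⊙-distribˡ-⊕ c u v)

  ⊙-distribʳ-+ᶠ : ∀ a b (v : 𝔽ⁿ n) → (a +ᶠ b) ⊙ v ≡ a ⊙ v ⊕ b ⊙ v
  ⊙-distribʳ-+ᶠ a b []      = refl
  ⊙-distribʳ-+ᶠ a b (x ∷ v) = cong₂ _∷_ (*ᶠ-distribʳ-+ᶠ x a b) (⊙-distribʳ-+ᶠ a b v)

  ⊙-assoc : ∀ a b (v : 𝔽ⁿ n) → (a *ᶠ b) ⊙ v ≡ a ⊙ b ⊙ v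
  ⊙-assoc a b []      = refl
  ⊙-assoc a b (x ∷ v) = cong₂ _∷_ (*ᶠ-assoc a b x) (⊙-assoc a b v)

  ⊙-identityˡ : (v : 𝔽ⁿ n) → 1ᶠ ⊙ v ≡ v
  ⊙-identityˡ []      = refl
  ⊙-identityˡ (x ∷ v) = cong₂ _∷_ (*ᶠ-identityˡ x) (⊙-identityˡ v)

  ⊙-zeroˡ : (v : 𝔽ⁿ n) → 0ᶠ ⊙ v ≡ 𝟎 n
  ⊙-zeroˡ []      = refl
  ⊙-zeroˡ (x ∷ v) = cong₂ _∷_ (*ᶠ-zeroˡ x) (⊙-zeroˡ v)

  ⊙-zeroʳ : ∀ c → c ⊙ 𝟎 n ≡ 𝟎 n
  ⊙-zeroʳ {zero}  c = refl
  ⊙-zeroʳ {suc n} c = cong₂ _∷_ (*ᶠ-zeroʳ c) (⊙-zeroʳ c)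

  ⊕≡𝟎⇒≡-1⊙ : (u v : 𝔽ⁿ n) → u ⊕ v ≡ 𝟎 n → u ≡ -1ᶠ ⊙ v
  ⊕≡𝟎⇒≡-1⊙ {n} u v eq = begin
    u                        ≡⟨ sym (⊕-identityʳ u) ⟩
    u ⊕ 𝟎 n                  ≡⟨ cong (u ⊕_) (sym (⊕-inverseʳ v)) ⟩
    u ⊕ (v ⊕ -1ᶠ ⊙ v)        ≡⟨ sym (⊕-assoc u v _) ⟩
    u ⊕ v ⊕ -1ᶠ ⊙ v          ≡⟨ cong (_⊕ -1ᶠ ⊙ v) eq ⟩
    𝟎 n ⊕ -1ᶠ ⊙ v            ≡⟨ ⊕-identityˡ _ ⟩
    -1ᶠ ⊙ v                  ∎
    where open ≡-Reasoning

  ⊕-1⊙≡𝟎⇒≡ : (u v : 𝔽ⁿ n) → u ⊕ -1ᶠ ⊙ v ≡ 𝟎 n → u ≡ v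
  ⊕-1⊙≡𝟎⇒≡ u v eq = begin
    u                     ≡⟨ ⊕≡𝟎⇒≡-1⊙ u _ eq ⟩
    -1ᶠ ⊙ -1ᶠ ⊙ v         ≡⟨ sym (⊙-assoc -1ᶠ -1ᶠ v) ⟩
    (-1ᶠ *ᶠ -1ᶠ) ⊙ v      ≡⟨ cong (_⊙ v) -1ᶠ*-1ᶠ ⟩
    1ᶠ ⊙ v                ≡⟨ ⊙-identityˡ v ⟩
    v                     ∎
    where open ≡-Reasoning

  lincomb-𝟎 : (ws : Vec (𝔽ⁿ n) d) → lincomb p (𝟎 d) ws ≡ 𝟎 n
  lincomb-𝟎 []       = refl
  lincomb-𝟎 (w ∷ ws) = trans (cong₂ _⊕_ (⊙-zeroˡ w) (lincomb-𝟎 ws)) (⊕-identityˡ _)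

  lincomb-⊕ : (cs ds : 𝔽ⁿ d) (ws : Vec (𝔽ⁿ n) d) →
              lincomb p (cs ⊕ ds) ws ≡ lincomb p cs ws ⊕ lincomb p ds ws
  lincomb-⊕ []       []       []       = sym (⊕-identityˡ _)
  lincomb-⊕ (c ∷ cs) (d ∷ ds) (w ∷ ws) =
    trans (cong₂ _⊕_ (⊙-distribʳ-+ᶠ c d w) (lincomb-⊕ cs ds ws)) (⊕-interchange (c ⊙ w) (d ⊙ w) _ _)

  lincomb-⊙ : ∀ a (cs : 𝔽ⁿ d) (ws : Vec (𝔽ⁿ n) d) → lincomb p (a ⊙ cs) ws ≡ a ⊙ lincomb p cs ws
  lincomb-⊙ a []       []       = sym (⊙-zeroʳ a)
  lincomb-⊙ a (c ∷ cs) (w ∷ ws) =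
    trans (cong₂ _⊕_ (⊙-assoc a c w) (lincomb-⊙ a cs ws)) (sym (⊙-distribˡ-⊕ a (c ⊙ w) _))

  Span : Vec (𝔽ⁿ n) d → 𝔽ⁿ n → Set
  Span {d = d} ws x = Σ (𝔽ⁿ d) λ cs → lincomb p cs ws ≡ x

  Span-𝟎 : (ws : Vec (𝔽ⁿ n) d) → Span ws (𝟎 n)
  Span-𝟎 {d = d} ws = 𝟎 d , lincomb-𝟎 ws

  Span-⊕ : (ws : Vec (𝔽ⁿ n) d) {x y : 𝔽ⁿ n} → Span ws x → Span ws y → Span ws (x ⊕ y)
  Span-⊕ ws (cs , refl) (ds , refl) = cs ⊕ ds , lincomb-⊕ cs ds ws

  Span-⊙ : (ws : Vec (𝔽ⁿ n) d) (a : 𝔽) {x : 𝔽ⁿ n} → Span ws x → Span ws (a ⊙ x)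
  Span-⊙ ws a (cs , refl) = a ⊙ cs , lincomb-⊙ a cs ws

  Span-lincomb : (ws : Vec (𝔽ⁿ n) d) (us : Vec (𝔽ⁿ n) e) → VecAll.All (Span ws) us →
                 ∀ cs → Span ws (lincomb p cs us)
  Span-lincomb ws []       VecAll.[]          []       = Span-𝟎 ws
  Span-lincomb ws (u ∷ us) (u∈ VecAll.∷ us∈) (c ∷ cs) = Span-⊕ ws (Span-⊙ ws c u∈) (Span-lincomb ws us us∈ cs)

  Span-self : (ws : Vec (𝔽ⁿ n) d) → VecAll.All (Span ws) ws
  Span-self []                 = VecAll.[]
  Span-self {d = suc d} (w ∷ ws) =
    (1ᶠ ∷ 𝟎 d , trans (cong₂ _⊕_ (⊙-identityˡ w) (lincomb-𝟎 ws)) (⊕-identityʳ w))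
    VecAll.∷ VecAll.map (λ { (cs , refl) → 0ᶠ ∷ cs , trans (cong (_⊕ _) (⊙-zeroˡ w)) (⊕-identityˡ _) }) (Span-self ws)

  all𝔽ⁿ : ∀ n → List (𝔽ⁿ n)
  all𝔽ⁿ = vectors (List.allFin p)

  ∈-all𝔽ⁿ : (v : 𝔽ⁿ n) → v ∈ all𝔽ⁿ n
  ∈-all𝔽ⁿ = ∈-vectors ∈-allFin

  all𝔽ⁿ-unique : ∀ n → Unique (all𝔽ⁿ n)
  all𝔽ⁿ-unique = vectors-unique (Uniqueₚ.allFin⁺ p)

  length-all𝔽ⁿ : ∀ n → length (all𝔽ⁿ n) ≡ p ^ n
  length-all𝔽ⁿ n = trans (length-vectors _ n) (cong (_^ n) (Listₚ.length-tabulate (λ i → i)))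

  _≟ⁿ_ : (u v : 𝔽ⁿ n) → Dec (u ≡ v)
  _≟ⁿ_ = Vecₚ.≡-dec Finₚ._≟_

  Span? : (ws : Vec (𝔽ⁿ n) d) → ∀ x → Dec (Span ws x)
  Span? {d = d} ws x with any? (λ cs → lincomb p cs ws ≟ⁿ x) (all𝔽ⁿ d)
  ... | yes found = yes (Any.satisfied found)
  ... | no ¬found = no λ (cs , eq) → ¬found (lose (∈-all𝔽ⁿ cs) eq)

  LinIndep⇒lincomb-injective : (ws : Vec (𝔽ⁿ n) d) → LinIndep p ws →
                               ∀ cs ds → lincomb p cs ws ≡ lincomb p ds ws → cs ≡ ds
  LinIndep⇒lincomb-injective {n} ws indep cs ds eq = ⊕-1⊙≡𝟎⇒≡ cs ds (indep _ (begin
    lincomb p (cs ⊕ -1ᶠ ⊙ ds) ws                ≡⟨ lincomb-⊕ cs _ ws ⟩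
    lincomb p cs ws ⊕ lincomb p (-1ᶠ ⊙ ds) ws   ≡⟨ cong (lincomb p cs ws ⊕_) (lincomb-⊙ -1ᶠ ds ws) ⟩
    lincomb p cs ws ⊕ -1ᶠ ⊙ lincomb p ds ws     ≡⟨ cong (λ x → x ⊕ -1ᶠ ⊙ lincomb p ds ws) eq ⟩
    lincomb p ds ws ⊕ -1ᶠ ⊙ lincomb p ds ws     ≡⟨ ⊕-inverseʳ _ ⟩
    𝟎 n                                         ∎))
    where open ≡-Reasoning

  count-Span : (ws : Vec (𝔽ⁿ n) d) → LinIndep p ws → count (Span? ws) (all𝔽ⁿ n) ≡ p ^ d
  count-Span {n} {d} ws indep = begin
    count (Span? ws) (all𝔽ⁿ n)              ≡⟨ count≡length-filter (Span? ws) (all𝔽ⁿ n) ⟩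
    length (filter (Span? ws) (all𝔽ⁿ n))    ≡⟨ Unique∧same-elements⇒length≡
                                                  (Uniqueₚ.filter⁺ (Span? ws) (all𝔽ⁿ-unique n))
                                                  (Uniqueₚ.map⁺ (LinIndep⇒lincomb-injective ws indep _ _) (all𝔽ⁿ-unique d))
                                                  same ⟩
    length (map combine (all𝔽ⁿ d))          ≡⟨ Listₚ.length-map combine (all𝔽ⁿ d) ⟩
    length (all𝔽ⁿ d)                        ≡⟨ length-all𝔽ⁿ d ⟩
    p ^ d                                   ∎
    where
    open ≡-Reasoning
    combine : 𝔽ⁿ d → 𝔽ⁿ n
    combine cs = lincomb p cs ws
    same : ∀ x → (x ∈ filter (Span? ws) (all𝔽ⁿ n)) ⇔ (x ∈ map combine (all𝔽ⁿ d))
    same x = (λ x∈ → let cs , eq = proj₂ (∈-filter⁻ (Span? ws) {xs = all𝔽ⁿ n} x∈)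
                     in subst (_∈ map combine (all𝔽ⁿ d)) eq (∈-map⁺ combine (∈-all𝔽ⁿ cs)))
           , (λ x∈ → let cs , _ , eq = ∈-map⁻ combine x∈
                     in ∈-filter⁺ (Span? ws) (∈-all𝔽ⁿ x) (cs , sym eq))

module PrimeField (p : ℕ) .{{_ : NonZero p}} (prime : Prime p) where

  open Modular p public

  1<p : 1 < p
  1<p = ℕ.nonTrivial⇒n>1 p {{prime⇒nonTrivial prime}}

  1ᶠ≢0ᶠ : ¬ 1ᶠ ≡ 0ᶠ
  1ᶠ≢0ᶠ eq = ℕₚ.1+n≢0 (begin
    1          ≡⟨ sym (m<n⇒m%n≡m 1<p) ⟩
    1 % p      ≡⟨ sym (toℕ-[] 1) ⟩
    toℕ 1ᶠ     ≡⟨ cong toℕ eq ⟩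
    toℕ 0ᶠ     ≡⟨ toℕ-[] 0 ⟩
    0 % p      ≡⟨ m<n⇒m%n≡m (ℕ.>-nonZero⁻¹ p) ⟩
    0          ∎)
    where open ≡-Reasoning

  -1ᶠ≢0ᶠ : ¬ -1ᶠ ≡ 0ᶠ
  -1ᶠ≢0ᶠ eq = 1ᶠ≢0ᶠ (begin
    1ᶠ                 ≡⟨ sym (+ᶠ-identityʳ 1ᶠ) ⟩
    1ᶠ +ᶠ 0ᶠ           ≡⟨ cong (1ᶠ +ᶠ_) (sym (*ᶠ-zeroˡ 1ᶠ)) ⟩
    1ᶠ +ᶠ 0ᶠ *ᶠ 1ᶠ     ≡⟨ cong (λ c → 1ᶠ +ᶠ c *ᶠ 1ᶠ) (sym eq) ⟩
    1ᶠ +ᶠ -1ᶠ *ᶠ 1ᶠ    ≡⟨ +ᶠ-inverseʳ 1ᶠ ⟩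
    0ᶠ                 ∎)
    where open ≡-Reasoning

  *ᶠ-inverseˡ : ∀ a → ¬ a ≡ 0ᶠ → Σ 𝔽 λ b → b *ᶠ a ≡ 1ᶠ
  *ᶠ-inverseˡ a a≢0 = from-Bézout (coprime-Bézout (Coprime.sym (prime⇒coprime prime (Finₚ.toℕ<n a))))
    where
    instance
      nonZero-a : NonZero (toℕ a)
      nonZero-a = ℕ.≢-nonZero λ eq → a≢0 (trans (sym ([toℕ] a)) (cong [_] eq))
    from-Bézout : Bézout.Identity 1 (toℕ a) p → Σ 𝔽 λ b → b *ᶠ a ≡ 1ᶠ
    from-Bézout (Bézout.+- x y eq) = [ x ] , (begin
      [ x ] *ᶠ a               ≡⟨ cong ([ x ] *ᶠ_) (sym ([toℕ] a)) ⟩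
      [ x ] *ᶠ [ toℕ a ]       ≡⟨ []-* x (toℕ a) ⟩
      [ x * toℕ a ]            ≡⟨ cong [_] (sym eq) ⟩
      [ 1 + y * p ]            ≡⟨ []-+kp 1 y ⟩
      1ᶠ                       ∎)
      where open ≡-Reasoning
    -- here x · a ≡ -1 (mod p), so -x = (p - 1) x is the inverse
    from-Bézout (Bézout.-+ x y eq) = [ x * ℕ.pred p ] , (begin
      [ x * ℕ.pred p ] *ᶠ a                        ≡⟨ cong ([ x * ℕ.pred p ] *ᶠ_) (sym ([toℕ] a)) ⟩
      [ x * ℕ.pred p ] *ᶠ [ toℕ a ]                ≡⟨ []-* (x * ℕ.pred p) (toℕ a) ⟩
      [ x * ℕ.pred p * toℕ a ]                     ≡⟨ sym ([]-+kp _ y) ⟩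
      [ x * ℕ.pred p * toℕ a + y * p ]             ≡⟨ cong (λ m → [ x * ℕ.pred p * toℕ a + m ]) (sym eq) ⟩
      [ x * ℕ.pred p * toℕ a + (1 + x * toℕ a) ]   ≡⟨ cong [_] (rearrange x (ℕ.pred p) (toℕ a)) ⟩
      [ 1 + x * toℕ a * suc (ℕ.pred p) ]           ≡⟨ cong (λ m → [ 1 + x * toℕ a * m ]) (ℕₚ.suc-pred p) ⟩
      [ 1 + x * toℕ a * p ]                        ≡⟨ []-+kp 1 (x * toℕ a) ⟩
      1ᶠ                                           ∎)
      where
      open ≡-Reasoning
      rearrange : ∀ x q m → x * q * m + (1 + x * m) ≡ 1 + x * m * suc q
      rearrange = solve 3 (λ x q m → x :* q :* m :+ (con 1 :+ x :* m) := con 1 :+ x :* m :* (con 1 :+ q)) refl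
        where open +-*-Solver

  LinIndep-[] : LinIndep p {n} []
  LinIndep-[] [] _ = refl

  LinIndep-tail : (v : 𝔽ⁿ n) (ws : Vec (𝔽ⁿ n) d) → LinIndep p (v ∷ ws) → LinIndep p ws
  LinIndep-tail v ws indep cs eq with indep (0ᶠ ∷ cs) (trans (cong₂ _⊕_ (⊙-zeroˡ v) eq) (⊕-identityˡ _))
  ... | refl = refl

  LinIndep-head : (v : 𝔽ⁿ n) (ws : Vec (𝔽ⁿ n) d) → LinIndep p (v ∷ ws) → ¬ Span ws v
  LinIndep-head v ws indep (cs , eq) =
    -1ᶠ≢0ᶠ (Vecₚ.∷-injectiveˡ (indep (-1ᶠ ∷ cs) (begin
      -1ᶠ ⊙ v ⊕ lincomb p cs ws   ≡⟨ cong (-1ᶠ ⊙ v ⊕_) eq ⟩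
      -1ᶠ ⊙ v ⊕ v                 ≡⟨ ⊕-comm _ v ⟩
      v ⊕ -1ᶠ ⊙ v                 ≡⟨ ⊕-inverseʳ v ⟩
      𝟎 _                         ∎)))
    where open ≡-Reasoning

  LinIndep-∷ : (v : 𝔽ⁿ n) (ws : Vec (𝔽ⁿ n) d) → LinIndep p ws → ¬ Span ws v → LinIndep p (v ∷ ws)
  LinIndep-∷ v ws indep v∉ (c ∷ cs) eq with c Finₚ.≟ 0ᶠ
  ... | yes refl = cong (0ᶠ ∷_) (indep cs (trans (sym (⊕-identityˡ _)) (trans (cong (_⊕ _) (sym (⊙-zeroˡ v))) eq)))
  ... | no c≢0   = ⊥-elim (v∉ ((b *ᶠ -1ᶠ) ⊙ cs , (begin
      lincomb p ((b *ᶠ -1ᶠ) ⊙ cs) ws   ≡⟨ lincomb-⊙ (b *ᶠ -1ᶠ) cs ws ⟩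
      (b *ᶠ -1ᶠ) ⊙ lincomb p cs ws     ≡⟨ ⊙-assoc b -1ᶠ _ ⟩
      b ⊙ -1ᶠ ⊙ lincomb p cs ws        ≡⟨ cong (b ⊙_) (sym (⊕≡𝟎⇒≡-1⊙ _ _ eq)) ⟩
      b ⊙ c ⊙ v                        ≡⟨ sym (⊙-assoc b c v) ⟩
      (b *ᶠ c) ⊙ v                     ≡⟨ cong (_⊙ v) b*c≡1 ⟩
      1ᶠ ⊙ v                           ≡⟨ ⊙-identityˡ v ⟩
      v                                ∎)))
    where
    open ≡-Reasoning
    b : 𝔽
    b = proj₁ (*ᶠ-inverseˡ c c≢0)
    b*c≡1 : b *ᶠ c ≡ 1ᶠ
    b*c≡1 = proj₂ (*ᶠ-inverseˡ c c≢0)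

  LinIndep? : (ws : Vec (𝔽ⁿ n) d) → Dec (LinIndep p ws)
  LinIndep? []       = yes LinIndep-[]
  LinIndep? (v ∷ ws) with LinIndep? ws | Span? ws v
  ... | no ¬indep | _       = no λ indep → ¬indep (LinIndep-tail v ws indep)
  ... | yes _     | yes v∈  = no λ indep → LinIndep-head v ws indep v∈
  ... | yes indep | no v∉   = yes (LinIndep-∷ v ws indep v∉)

  LinIndep-[_] : (v : 𝔽ⁿ n) → ¬ v ≡ 𝟎 n → LinIndep p (v ∷ [])
  LinIndep-[ v ] v≢0 = LinIndep-∷ v [] LinIndep-[] λ { ([] , eq) → v≢0 (sym eq) }

-- Gaussian binomial coefficients

gaussian : ℕ → ℕ → ℕ → ℕ
gaussian q n       zero    = 1
gaussian q zero    (suc k) = 0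
gaussian q (suc n) (suc k) = gaussian q n k + q ^ suc k * gaussian q n (suc k)

infixl 6 _+ᴺ_

_+ᴺ_ : List ℕ → List ℕ → List ℕ
[]      +ᴺ g       = g
(c ∷ f) +ᴺ []      = c ∷ f
(c ∷ f) +ᴺ (d ∷ g) = (c + d) ∷ (f +ᴺ g)

X^_*ᴺ_ : ℕ → List ℕ → List ℕ
X^ zero  *ᴺ f = f
X^ suc m *ᴺ f = 0 ∷ X^ m *ᴺ f

gaussianPoly : ℕ → ℕ → List ℕ
gaussianPoly n       zero    = 1 ∷ []
gaussianPoly zero    (suc k) = []
gaussianPoly (suc n) (suc k) = gaussianPoly n k +ᴺ X^ suc k *ᴺ gaussianPoly n (suc k)

evalℕ-+ᴺ : ∀ f g x → evalℕ (f +ᴺ g) x ≡ evalℕ f x + evalℕ g x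
evalℕ-+ᴺ []      g       x = refl
evalℕ-+ᴺ (c ∷ f) []      x = sym (ℕₚ.+-identityʳ _)
evalℕ-+ᴺ (c ∷ f) (d ∷ g) x rewrite evalℕ-+ᴺ f g x =
  solve 5 (λ c d x F G → (c :+ d) :+ x :* (F :+ G) := (c :+ x :* F) :+ (d :+ x :* G)) refl c d x (evalℕ f x) (evalℕ g x)
  where open +-*-Solver

evalℕ-X^*ᴺ : ∀ m f x → evalℕ (X^ m *ᴺ f) x ≡ x ^ m * evalℕ f x
evalℕ-X^*ᴺ zero    f x = sym (ℕₚ.*-identityˡ _)
evalℕ-X^*ᴺ (suc m) f x = trans (cong (x *_) (evalℕ-X^*ᴺ m f x)) (sym (ℕₚ.*-assoc x (x ^ m) _))

evalℕ-gaussianPoly : ∀ q n k → evalℕ (gaussianPoly n k) q ≡ gaussian q n k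
evalℕ-gaussianPoly q n       zero    = cong suc (ℕₚ.*-zeroʳ q)
evalℕ-gaussianPoly q zero    (suc k) = refl
evalℕ-gaussianPoly q (suc n) (suc k) = begin
  evalℕ (gaussianPoly n k +ᴺ X^ suc k *ᴺ gaussianPoly n (suc k)) q
    ≡⟨ evalℕ-+ᴺ (gaussianPoly n k) _ q ⟩
  evalℕ (gaussianPoly n k) q + evalℕ (X^ suc k *ᴺ gaussianPoly n (suc k)) q
    ≡⟨ cong (evalℕ (gaussianPoly n k) q +_) (evalℕ-X^*ᴺ (suc k) (gaussianPoly n (suc k)) q) ⟩
  evalℕ (gaussianPoly n k) q + q ^ suc k * evalℕ (gaussianPoly n (suc k)) q
    ≡⟨ cong₂ (λ u v → u + q ^ suc k * v) (evalℕ-gaussianPoly q n k) (evalℕ-gaussianPoly q n (suc k)) ⟩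
  gaussian q (suc n) (suc k) ∎
  where open ≡-Reasoning

ν-polynomial : ℕ → ℕ → ℕ → List ℕ
ν-polynomial n′ k′ l = X^ l *ᴺ gaussianPoly n′ k′ +ᴺ X^ suc k′ *ᴺ gaussianPoly n′ (suc k′)

evalℕ-ν-polynomial : ∀ q n′ k′ l →
  evalℕ (ν-polynomial n′ k′ l) q ≡ q ^ l * gaussian q n′ k′ + q ^ suc k′ * gaussian q n′ (suc k′)
evalℕ-ν-polynomial q n′ k′ l = begin
  evalℕ (ν-polynomial n′ k′ l) q
    ≡⟨ evalℕ-+ᴺ (X^ l *ᴺ gaussianPoly n′ k′) _ q ⟩
  evalℕ (X^ l *ᴺ gaussianPoly n′ k′) q + evalℕ (X^ suc k′ *ᴺ gaussianPoly n′ (suc k′)) q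
    ≡⟨ cong₂ _+_ (evalℕ-X^*ᴺ l (gaussianPoly n′ k′) q) (evalℕ-X^*ᴺ (suc k′) (gaussianPoly n′ (suc k′)) q) ⟩
  q ^ l * evalℕ (gaussianPoly n′ k′) q + q ^ suc k′ * evalℕ (gaussianPoly n′ (suc k′)) q
    ≡⟨ cong₂ (λ u v → q ^ l * u + q ^ suc k′ * v) (evalℕ-gaussianPoly q n′ k′) (evalℕ-gaussianPoly q n′ (suc k′)) ⟩
  q ^ l * gaussian q n′ k′ + q ^ suc k′ * gaussian q n′ (suc k′) ∎
  where open ≡-Reasoning

pow∸1 : ℕ → ℕ → ℕ
pow∸1 q x = q ^ x ∸ 1

falling : ℕ → ℕ → ℕ → ℕ
falling q n zero    = 1
falling q n (suc i) = pow∸1 q (n ∸ i) * falling q n i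

powers : ℕ → ℕ → ℕ → ℕ
powers q j zero    = 1
powers q j (suc i) = q ^ (i + j) * powers q j i

-- the number of ways to extend j independent vectors of 𝔽_q^K by i further
-- vectors to an independent family
extensions : ℕ → ℕ → ℕ → ℕ → ℕ
extensions q K j zero    = 1
extensions q K j (suc i) = (q ^ K ∸ q ^ (i + j)) * extensions q K j i

module _ {q : ℕ} (1<q : 1 < q) where

  private instance
    nonZero-q : NonZero q
    nonZero-q = ℕ.>-nonZero (ℕₚ.<-trans (s≤s z≤n) 1<q)

  falling-suc : ∀ n i → falling q (suc n) (suc i) ≡ pow∸1 q (suc n) * falling q n i
  falling-suc n zero    = refl
  falling-suc n (suc i) = begin
    pow∸1 q (n ∸ i) * falling q (suc n) (suc i)        ≡⟨ cong (pow∸1 q (n ∸ i) *_) (falling-suc n i) ⟩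
    pow∸1 q (n ∸ i) * (pow∸1 q (suc n) * falling q n i) ≡⟨ *-left-comm (pow∸1 q (n ∸ i)) (pow∸1 q (suc n)) (falling q n i) ⟩
    pow∸1 q (suc n) * falling q n (suc i)              ∎
    where open ≡-Reasoning

  falling-vanishes : ∀ n i → n < i → falling q n i ≡ 0
  falling-vanishes n (suc i) (s≤s n≤i) with n ℕ.≟ i
  ... | yes refl = cong (λ m → pow∸1 q m * falling q n i) (ℕₚ.n∸n≡0 n)
  ... | no n≢i   = trans (cong (pow∸1 q (n ∸ i) *_) (falling-vanishes n i (ℕₚ.≤∧≢⇒< n≤i n≢i)))
                         (ℕₚ.*-zeroʳ (pow∸1 q (n ∸ i)))

  pow∸1-+ : ∀ n k → k ≤ n → pow∸1 q (suc k) + q ^ suc k * pow∸1 q (n ∸ k) ≡ pow∸1 q (suc n)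
  pow∸1-+ n k k≤n = begin
    (q ^ suc k ∸ 1) + q ^ suc k * (q ^ (n ∸ k) ∸ 1)
      ≡⟨ cong₂ (λ u v → (u ∸ 1) + u * (v ∸ 1)) (sym (ℕₚ.suc-pred (q ^ suc k))) (sym (ℕₚ.suc-pred (q ^ (n ∸ k)))) ⟩
    a + suc a * b                                  ≡⟨ solve 2 (λ a b → a :+ (con 1 :+ a) :* b := b :+ a :* (con 1 :+ b)) refl a b ⟩
    suc a * suc b ∸ 1                              ≡⟨ cong₂ (λ u v → u * v ∸ 1) (ℕₚ.suc-pred (q ^ suc k)) (ℕₚ.suc-pred (q ^ (n ∸ k))) ⟩
    q ^ suc k * q ^ (n ∸ k) ∸ 1                    ≡⟨ cong (_∸ 1) (sym (ℕₚ.^-distribˡ-+-* q (suc k) (n ∸ k))) ⟩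
    q ^ (suc k + (n ∸ k)) ∸ 1                      ≡⟨ cong (λ m → q ^ suc m ∸ 1) (ℕₚ.m+[n∸m]≡n k≤n) ⟩
    q ^ suc n ∸ 1                                  ∎
    where
    open ≡-Reasoning
    open +-*-Solver
    instance
      _ : NonZero (q ^ suc k)
      _ = ℕₚ.m^n≢0 q (suc k)
      _ : NonZero (q ^ (n ∸ k))
      _ = ℕₚ.m^n≢0 q (n ∸ k)
    a b : ℕ
    a = ℕ.pred (q ^ suc k)
    b = ℕ.pred (q ^ (n ∸ k))

  gaussian-falling : ∀ n k → gaussian q n k * falling q k k ≡ falling q n k
  gaussian-falling n       zero    = refl
  gaussian-falling zero    (suc k) = sym (cong (λ m → pow∸1 q m * falling q 0 k) (ℕₚ.0∸n≡0 k))
  gaussian-falling (suc n) (suc k) = begin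
    (gaussian q n k + q ^ suc k * gaussian q n (suc k)) * falling q (suc k) (suc k)
      ≡⟨ ℕₚ.*-distribʳ-+ (falling q (suc k) (suc k)) (gaussian q n k) _ ⟩
    gaussian q n k * falling q (suc k) (suc k) + q ^ suc k * gaussian q n (suc k) * falling q (suc k) (suc k)
      ≡⟨ cong₂ _+_ (cong (gaussian q n k *_) (falling-suc k k)) (ℕₚ.*-assoc (q ^ suc k) _ _) ⟩
    gaussian q n k * (pow∸1 q (suc k) * falling q k k) + q ^ suc k * (gaussian q n (suc k) * falling q (suc k) (suc k))
      ≡⟨ cong₂ _+_ (*-left-comm (gaussian q n k) (pow∸1 q (suc k)) (falling q k k)) (cong (q ^ suc k *_) (gaussian-falling n (suc k))) ⟩
    pow∸1 q (suc k) * (gaussian q n k * falling q k k) + q ^ suc k * falling q n (suc k)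
      ≡⟨ cong (λ m → pow∸1 q (suc k) * m + q ^ suc k * falling q n (suc k)) (gaussian-falling n k) ⟩
    pow∸1 q (suc k) * falling q n k + q ^ suc k * (pow∸1 q (n ∸ k) * falling q n k)
      ≡⟨ cong (pow∸1 q (suc k) * falling q n k +_) (sym (ℕₚ.*-assoc (q ^ suc k) _ _)) ⟩
    pow∸1 q (suc k) * falling q n k + q ^ suc k * pow∸1 q (n ∸ k) * falling q n k
      ≡⟨ sym (ℕₚ.*-distribʳ-+ (falling q n k) (pow∸1 q (suc k)) _) ⟩
    (pow∸1 q (suc k) + q ^ suc k * pow∸1 q (n ∸ k)) * falling q n k
      ≡⟨ split (k ℕ.≤? n) ⟩
    pow∸1 q (suc n) * falling q n k
      ≡⟨ sym (falling-suc n k) ⟩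
    falling q (suc n) (suc k) ∎
    where
    open ≡-Reasoning
    split : Dec (k ≤ n) → (pow∸1 q (suc k) + q ^ suc k * pow∸1 q (n ∸ k)) * falling q n k ≡ pow∸1 q (suc n) * falling q n k
    split (yes k≤n) = cong (_* falling q n k) (pow∸1-+ n k k≤n)
    split (no k≰n) rewrite falling-vanishes n k (ℕₚ.≰⇒> k≰n) =
      trans (ℕₚ.*-zeroʳ (pow∸1 q (suc k) + q ^ suc k * pow∸1 q (n ∸ k))) (sym (ℕₚ.*-zeroʳ (pow∸1 q (suc n))))

  pow-∸ : ∀ a m → q ^ a ∸ q ^ m ≡ q ^ m * pow∸1 q (a ∸ m)
  pow-∸ a m with m ℕ.≤? a
  ... | yes m≤a = begin
    q ^ a ∸ q ^ m                          ≡⟨ cong (λ x → q ^ x ∸ q ^ m) (sym (ℕₚ.m+[n∸m]≡n m≤a)) ⟩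
    q ^ (m + (a ∸ m)) ∸ q ^ m              ≡⟨ cong (_∸ q ^ m) (ℕₚ.^-distribˡ-+-* q m (a ∸ m)) ⟩
    q ^ m * q ^ (a ∸ m) ∸ q ^ m            ≡⟨ cong (q ^ m * q ^ (a ∸ m) ∸_) (sym (ℕₚ.*-identityʳ (q ^ m))) ⟩
    q ^ m * q ^ (a ∸ m) ∸ q ^ m * 1        ≡⟨ sym (ℕₚ.*-distribˡ-∸ (q ^ m) (q ^ (a ∸ m)) 1) ⟩
    q ^ m * pow∸1 q (a ∸ m)                ∎
    where open ≡-Reasoning
  ... | no m≰a = begin
    q ^ a ∸ q ^ m             ≡⟨ ℕₚ.m≤n⇒m∸n≡0 (ℕₚ.^-monoʳ-≤ q a≤m) ⟩
    0                         ≡⟨ sym (ℕₚ.*-zeroʳ (q ^ m)) ⟩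
    q ^ m * 0                 ≡⟨ cong (λ x → q ^ m * pow∸1 q x) (sym (ℕₚ.m≤n⇒m∸n≡0 a≤m)) ⟩
    q ^ m * pow∸1 q (a ∸ m)   ∎
    where
    open ≡-Reasoning
    a≤m : a ≤ m
    a≤m = ℕₚ.<⇒≤ (ℕₚ.≰⇒> m≰a)

  extensions≡powers*falling : ∀ K j i → extensions q K j i ≡ powers q j i * falling q (K ∸ j) i
  extensions≡powers*falling K j zero    = refl
  extensions≡powers*falling K j (suc i) = begin
    (q ^ K ∸ q ^ (i + j)) * extensions q K j i
      ≡⟨ cong₂ _*_ (pow-∸ K (i + j)) (extensions≡powers*falling K j i) ⟩
    q ^ (i + j) * pow∸1 q (K ∸ (i + j)) * (powers q j i * falling q (K ∸ j) i)
      ≡⟨ cong (λ x → q ^ (i + j) * pow∸1 q x * (powers q j i * falling q (K ∸ j) i)) K∸[i+j]≡K∸j∸i ⟩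
    q ^ (i + j) * pow∸1 q (K ∸ j ∸ i) * (powers q j i * falling q (K ∸ j) i)
      ≡⟨ solve 4 (λ a b c d → a :* b :* (c :* d) := a :* c :* (b :* d)) refl
           (q ^ (i + j)) (pow∸1 q (K ∸ j ∸ i)) (powers q j i) (falling q (K ∸ j) i) ⟩
    q ^ (i + j) * powers q j i * (pow∸1 q (K ∸ j ∸ i) * falling q (K ∸ j) i) ∎
    where
    open ≡-Reasoning
    open +-*-Solver
    K∸[i+j]≡K∸j∸i : K ∸ (i + j) ≡ K ∸ j ∸ i
    K∸[i+j]≡K∸j∸i = trans (cong (K ∸_) (ℕₚ.+-comm i j)) (sym (ℕₚ.∸-+-assoc K j i))

  powers-nonZero : ∀ j i → NonZero (powers q j i)
  powers-nonZero j zero    = _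
  powers-nonZero j (suc i) = ℕₚ.m*n≢0 (q ^ (i + j)) _ {{ℕₚ.m^n≢0 q (i + j)}} {{powers-nonZero j i}}

  pow∸1-nonZero : ∀ x → 0 < x → NonZero (pow∸1 q x)
  pow∸1-nonZero (suc x) _ = ℕ.>-nonZero (ℕₚ.m<n⇒0<n∸m (ℕₚ.^-monoʳ-< q 1<q {0} {suc x} (s≤s z≤n)))

  falling-nonZero : ∀ k i → i ≤ k → NonZero (falling q k i)
  falling-nonZero k zero    _   = _
  falling-nonZero k (suc i) i<k =
    ℕₚ.m*n≢0 _ _ {{pow∸1-nonZero (k ∸ i) (ℕₚ.m<n⇒0<n∸m i<k)}} {{falling-nonZero k i (ℕₚ.<⇒≤ i<k)}}

  gaussian-unique : ∀ N n k j → N * extensions q (j + k) j k ≡ extensions q (j + n) j k → N ≡ gaussian q n k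
  gaussian-unique N n k j eq =
    ℕₚ.*-cancelʳ-≡ N (gaussian q n k) (falling q k k) {{falling-nonZero k k ℕₚ.≤-refl}}
      (ℕₚ.*-cancelˡ-≡ _ _ (powers q j k) {{powers-nonZero j k}} (begin
        powers q j k * (N * falling q k k)                    ≡⟨ *-left-comm (powers q j k) N (falling q k k) ⟩
        N * (powers q j k * falling q k k)                    ≡⟨ cong (λ x → N * (powers q j k * falling q x k)) (sym (ℕₚ.m+n∸m≡n j k)) ⟩
        N * (powers q j k * falling q (j + k ∸ j) k)          ≡⟨ cong (N *_) (sym (extensions≡powers*falling (j + k) j k)) ⟩
        N * extensions q (j + k) j k                          ≡⟨ eq ⟩
        extensions q (j + n) j k                              ≡⟨ extensions≡powers*falling (j + n) j k ⟩
        powers q j k * falling q (j + n ∸ j) k                ≡⟨ cong (λ x → powers q j k * falling q x k) (ℕₚ.m+n∸m≡n j n) ⟩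
        powers q j k * falling q n k                          ≡⟨ cong (powers q j k *_) (sym (gaussian-falling n k)) ⟩
        powers q j k * (gaussian q n k * falling q k k)       ∎))
    where open ≡-Reasoning

  falling-+ : ∀ n a b → falling q n (a + b) ≡ falling q n a * falling q (n ∸ a) b
  falling-+ n a zero    = trans (cong (falling q n) (ℕₚ.+-identityʳ a)) (sym (ℕₚ.*-identityʳ _))
  falling-+ n a (suc b) = begin
    falling q n (a + suc b)                                      ≡⟨ cong (falling q n) (ℕₚ.+-suc a b) ⟩
    pow∸1 q (n ∸ (a + b)) * falling q n (a + b)                  ≡⟨ cong₂ _*_ (cong (pow∸1 q) (sym (ℕₚ.∸-+-assoc n a b))) (falling-+ n a b) ⟩
    pow∸1 q (n ∸ a ∸ b) * (falling q n a * falling q (n ∸ a) b)  ≡⟨ *-left-comm (pow∸1 q (n ∸ a ∸ b)) (falling q n a) _ ⟩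
    falling q n a * falling q (n ∸ a) (suc b)                    ∎
    where open ≡-Reasoning

  gaussian-sym : ∀ n a → a ≤ n → gaussian q n a ≡ gaussian q n (n ∸ a)
  gaussian-sym n a a≤n = ℕₚ.*-cancelʳ-≡ (gaussian q n a) (gaussian q n b) (falling q a a * falling q b b)
    {{ℕₚ.m*n≢0 _ _ {{falling-nonZero a a ℕₚ.≤-refl}} {{falling-nonZero b b ℕₚ.≤-refl}}}} (begin
    gaussian q n a * (falling q a a * falling q b b)   ≡⟨ sym (ℕₚ.*-assoc (gaussian q n a) _ _) ⟩
    gaussian q n a * falling q a a * falling q b b     ≡⟨ cong (_* falling q b b) (gaussian-falling n a) ⟩
    falling q n a * falling q (n ∸ a) b                ≡⟨ sym (falling-+ n a b) ⟩
    falling q n (a + b)                                ≡⟨ cong (falling q n) (ℕₚ.+-comm a b) ⟩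
    falling q n (b + a)                                ≡⟨ cong (λ x → falling q n (b + x)) (sym n∸b≡a) ⟩
    falling q n (b + (n ∸ b))                          ≡⟨ falling-+ n b (n ∸ b) ⟩
    falling q n b * falling q (n ∸ b) (n ∸ b)          ≡⟨ cong (λ x → falling q n b * falling q x x) n∸b≡a ⟩
    falling q n b * falling q a a                      ≡⟨ cong (_* falling q a a) (sym (gaussian-falling n b)) ⟩
    gaussian q n b * falling q b b * falling q a a     ≡⟨ ℕₚ.*-assoc (gaussian q n b) _ _ ⟩
    gaussian q n b * (falling q b b * falling q a a)   ≡⟨ cong (gaussian q n b *_) (ℕₚ.*-comm (falling q b b) _) ⟩
    gaussian q n b * (falling q a a * falling q b b)   ∎)
    where
    open ≡-Reasoning
    b : ℕ
    b = n ∸ a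
    n∸b≡a : n ∸ b ≡ a
    n∸b≡a = ℕₚ.m∸[m∸n]≡n a≤n

^[n∸l]*^[k+l]≡^k*^n : ∀ q {n l} k → l ≤ n → q ^ (n ∸ l) * q ^ (k + l) ≡ q ^ k * q ^ n
^[n∸l]*^[k+l]≡^k*^n q {n} {l} k l≤n = begin
  q ^ (n ∸ l) * q ^ (k + l)    ≡⟨ sym (ℕₚ.^-distribˡ-+-* q (n ∸ l) (k + l)) ⟩
  q ^ (n ∸ l + (k + l))        ≡⟨ cong (q ^_) exponent ⟩
  q ^ (k + n)                  ≡⟨ ℕₚ.^-distribˡ-+-* q k n ⟩
  q ^ k * q ^ n                ∎
  where
  open ≡-Reasoning
  exponent : n ∸ l + (k + l) ≡ k + n
  exponent = begin
    n ∸ l + (k + l)   ≡⟨ cong (n ∸ l +_) (ℕₚ.+-comm k l) ⟩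
    n ∸ l + (l + k)   ≡⟨ sym (ℕₚ.+-assoc (n ∸ l) l k) ⟩
    n ∸ l + l + k     ≡⟨ cong (_+ k) (ℕₚ.m∸n+n≡m l≤n) ⟩
    n + k             ≡⟨ ℕₚ.+-comm n k ⟩
    k + n             ∎

-- Counting independent families and subspaces of 𝔽ₚⁿ

module Subspaces (p : ℕ) .{{_ : NonZero p}} (prime : Prime p) where

  open PrimeField p prime public

  tuples : ∀ n i → List (Vec (𝔽ⁿ n) i)
  tuples n = vectors (all𝔽ⁿ n)

  LinearlyClosed : (𝔽ⁿ n → Set) → Set
  LinearlyClosed {n} W = ∀ {d} (us : Vec (𝔽ⁿ n) d) → VecAll.All W us → ∀ x → Span us x → W x

  module IndependentFamilies {n k : ℕ} (W : 𝔽ⁿ n → Set) (W? : ∀ x → Dec (W x))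
                             (count-W : count W? (all𝔽ⁿ n) ≡ p ^ k) (closed : LinearlyClosed W) where

    Indep : Vec (𝔽ⁿ n) d → Set
    Indep us = LinIndep p us × VecAll.All W us

    Indep? : (us : Vec (𝔽ⁿ n) d) → Dec (Indep us)
    Indep? us = LinIndep? us ×-dec VecAll.all? W? us

    count-extend-by-one : (us : Vec (𝔽ⁿ n) d) →
                          count (λ v → Indep? (v ∷ us)) (all𝔽ⁿ n) ≡ indicator (Indep? us) * (p ^ k ∸ p ^ d)
    count-extend-by-one {d} us with Indep? us
    ... | no ¬indep = count-none _ (all𝔽ⁿ n) λ v _ (indep , all) → ¬indep (LinIndep-tail v us indep , VecAll.tail all)
    ... | yes (indep , all) = begin
      count (λ v → Indep? (v ∷ us)) (all𝔽ⁿ n)      ≡⟨ count-cong _ W∖Span? (all𝔽ⁿ n) (λ v _ → W∖Span⇔) ⟩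
      count W∖Span? (all𝔽ⁿ n)                       ≡⟨ sym (ℕₚ.m+n∸m≡n (count (Span? us) (all𝔽ⁿ n)) _) ⟩
      count (Span? us) (all𝔽ⁿ n) + count W∖Span? (all𝔽ⁿ n) ∸ count (Span? us) (all𝔽ⁿ n)
        ≡⟨ cong₂ _∸_ (sym (count-split (Span? us) W? (all𝔽ⁿ n) (closed us all))) (count-Span us indep) ⟩
      count W? (all𝔽ⁿ n) ∸ p ^ d                    ≡⟨ cong (_∸ p ^ d) count-W ⟩
      p ^ k ∸ p ^ d                                 ≡⟨ sym (ℕₚ.*-identityˡ _) ⟩
      1 * (p ^ k ∸ p ^ d)                           ∎
      where
      open ≡-Reasoning
      W∖Span? : ∀ v → Dec (W v × ¬ Span us v)
      W∖Span? v = W? v ×-dec ¬? (Span? us v)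
      W∖Span⇔ : ∀ {v} → Indep (v ∷ us) ⇔ (W v × ¬ Span us v)
      W∖Span⇔ {v} = (λ (indep′ , all′) → VecAll.head all′ , LinIndep-head v us indep′)
                  , (λ (w , v∉) → LinIndep-∷ v us indep v∉ , w VecAll.∷ all)

    count-extend : (base : Vec (𝔽ⁿ n) j) (i : ℕ) →
                   count (λ us → Indep? (us ++ base)) (tuples n i) ≡ indicator (Indep? base) * extensions p k j i
    count-extend base zero    = trans (ℕₚ.+-identityʳ _) (sym (ℕₚ.*-identityʳ _))
    count-extend {j} base (suc i) = begin
      count (λ us → Indep? (us ++ base)) (tuples n (suc i))
        ≡⟨ ∑-vectors-suc (λ us → indicator (Indep? (us ++ base))) (all𝔽ⁿ n) ⟩
      ∑ (λ v → count (λ us → Indep? (v ∷ us ++ base)) (tuples n i)) (all𝔽ⁿ n)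
        ≡⟨ ∑-swap (λ v us → indicator (Indep? (v ∷ us ++ base))) (all𝔽ⁿ n) (tuples n i) ⟩
      ∑ (λ us → count (λ v → Indep? (v ∷ us ++ base)) (all𝔽ⁿ n)) (tuples n i)
        ≡⟨ ∑-cong _ _ (tuples n i) (λ us _ → count-extend-by-one (us ++ base)) ⟩
      ∑ (λ us → indicator (Indep? (us ++ base)) * X) (tuples n i)
        ≡⟨ ∑-*ʳ X _ (tuples n i) ⟩
      X * count (λ us → Indep? (us ++ base)) (tuples n i)
        ≡⟨ cong (X *_) (count-extend base i) ⟩
      X * (indicator (Indep? base) * extensions p k j i)
        ≡⟨ *-left-comm X (indicator (Indep? base)) (extensions p k j i) ⟩
      indicator (Indep? base) * extensions p k j (suc i) ∎
      where
      open ≡-Reasoning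
      X : ℕ
      X = p ^ k ∸ p ^ (i + j)

  module _ {W : 𝔽ⁿ n → Set} where

    HasDim⇒Dec : HasDim p W k → ∀ x → Dec (W x)
    HasDim⇒Dec (ws , _ , W⇔Span) x with Span? ws x
    ... | yes x∈ = yes (proj₂ (W⇔Span x) x∈)
    ... | no x∉  = no λ w → x∉ (proj₁ (W⇔Span x) w)

    count-HasDim : (dim : HasDim p W k) → count (HasDim⇒Dec dim) (all𝔽ⁿ n) ≡ p ^ k
    count-HasDim dim@(ws , indep , W⇔Span) =
      trans (count-cong (HasDim⇒Dec dim) (Span? ws) (all𝔽ⁿ n) (λ x _ → W⇔Span x)) (count-Span ws indep)

    HasDim⇒LinearlyClosed : HasDim p W k → LinearlyClosed W
    HasDim⇒LinearlyClosed (ws , _ , W⇔Span) us all x (cs , refl) =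
      proj₂ (W⇔Span x) (Span-lincomb ws us (VecAll.map (λ {y} → proj₁ (W⇔Span y)) all) cs)

    -- W and the span of us are equally large and one contains the other
    HasDim⇒SameSet-Span : HasDim p W k → (us : Vec (𝔽ⁿ n) k) → LinIndep p us → VecAll.All W us →
                          SameSet p W (Span us)
    HasDim⇒SameSet-Span dim us indep all x =
        (λ w → ⊆∧count≡⇒⊇ (Span? us) (HasDim⇒Dec dim) (all𝔽ⁿ n) Span⊆W
                 (trans (count-Span us indep) (sym (count-HasDim dim))) (∈-all𝔽ⁿ x) w)
      , Span⊆W x
      where
      Span⊆W : ∀ y → Span us y → W y
      Span⊆W = HasDim⇒LinearlyClosed dim us all

    count-HasDim-𝟎 : (dim : HasDim p W k) → count (λ x → HasDim⇒Dec dim x ×-dec x ≟ⁿ 𝟎 n) (all𝔽ⁿ n) ≡ 1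
    count-HasDim-𝟎 (_ , _ , W⇔Span) = count≡1 _ (all𝔽ⁿ n)
      (lose (∈-all𝔽ⁿ (𝟎 n)) (proj₂ (W⇔Span (𝟎 n)) (Span-𝟎 _) , refl))
      (AllPairs.map (λ x≢y ((_ , x≡0) , (_ , y≡0)) → x≢y (trans x≡0 (sym y≡0))) (all𝔽ⁿ-unique n))

  Subspace : ℕ → ℕ → Set₁
  Subspace n k = Σ (𝔽ⁿ n → Set) λ W → HasDim p W k

  _∋?_ : (S : Subspace n k) → ∀ x → Dec (proj₁ S x)
  (_ , dim) ∋? x = HasDim⇒Dec dim x

  module FullSpace (n : ℕ) = IndependentFamilies {n} {n} (λ _ → ⊤) (λ _ → yes tt)
    (trans (count-all _ (all𝔽ⁿ n) (λ _ _ → tt)) (length-all𝔽ⁿ n)) (λ _ _ _ _ → tt)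

  module Enumeration {n k : ℕ} (ws : List (𝔽ⁿ n → Set)) (enum : EnumSubspaces p n k ws) where

    subspaces : List (Subspace n k)
    subspaces = All.toList (proj₁ enum)

    module Within (S : Subspace n k) = IndependentFamilies {n} {k} (proj₁ S) (S ∋?_)
      (count-HasDim (proj₂ S)) (HasDim⇒LinearlyClosed (proj₂ S))

    Contains? : (S : Subspace n k) (us : Vec (𝔽ⁿ n) d) → Dec (VecAll.All (proj₁ S) us)
    Contains? S = VecAll.all? (S ∋?_)

    -- the one subspace is the span of us
    count-Contains-independent : d ≡ k → (us : Vec (𝔽ⁿ n) d) → LinIndep p us →
                                 count (λ S → Contains? S us) subspaces ≡ 1
    count-Contains-independent refl us indep = count≡1 (λ S → Contains? S us) subspaces
      (Any.map (λ Span≡S → VecAll.map (λ {x} → proj₁ (Span≡S x)) (Span-self us))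
               (Any-toList (proj₁ enum) (proj₁ (proj₂ enum) (Span us) (us , indep , λ _ → (λ x∈ → x∈) , (λ x∈ → x∈)))))
      (AllPairs.map (λ {S} {S′} S≢S′ (S∋us , S′∋us) → S≢S′ (λ x →
                       let S⇔Span  = HasDim⇒SameSet-Span (proj₂ S)  us indep S∋us  x
                           S′⇔Span = HasDim⇒SameSet-Span (proj₂ S′) us indep S′∋us x
                       in (λ w → proj₂ S′⇔Span (proj₁ S⇔Span w)) , (λ w → proj₂ S⇔Span (proj₁ S′⇔Span w))))
                    (AllPairs-toList (proj₁ enum) (proj₂ (proj₂ enum))))

    count-Contains : (base : Vec (𝔽ⁿ n) j) (i : ℕ) → i + j ≡ k → LinIndep p base →
                     count (λ S → Contains? S base) subspaces * extensions p k j i ≡ extensions p n j i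
    count-Contains {j} base i i+j≡k indep = begin
      count (λ S → Contains? S base) subspaces * X
        ≡⟨ ℕₚ.*-comm _ X ⟩
      X * count (λ S → Contains? S base) subspaces
        ≡⟨ sym (∑-*ʳ X _ subspaces) ⟩
      ∑ (λ S → indicator (Contains? S base) * X) subspaces
        ≡⟨ ∑-cong _ _ subspaces (λ S _ → cong (_* X) (Contains⇔Indep S)) ⟩
      ∑ (λ S → indicator (Within.Indep? S base) * X) subspaces
        ≡⟨ sym (∑-cong _ _ subspaces (λ S _ → Within.count-extend S base i)) ⟩
      ∑ (λ S → count (λ us → Within.Indep? S (us ++ base)) (tuples n i)) subspaces
        ≡⟨ ∑-swap (λ S us → indicator (Within.Indep? S (us ++ base))) subspaces (tuples n i) ⟩
      ∑ (λ us → count (λ S → Within.Indep? S (us ++ base)) subspaces) (tuples n i)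
        ≡⟨ ∑-cong _ _ (tuples n i) (λ us _ → one-subspace-if-independent (us ++ base)) ⟩
      count (λ us → FullSpace.Indep? n (us ++ base)) (tuples n i)
        ≡⟨ FullSpace.count-extend n base i ⟩
      indicator (FullSpace.Indep? n base) * extensions p n j i
        ≡⟨ cong (_* extensions p n j i) (indicator-cong (FullSpace.Indep? n base) (yes tt) ((λ _ → tt) , λ _ → indep , VecAll.universal (λ _ → tt) base)) ⟩
      1 * extensions p n j i
        ≡⟨ ℕₚ.*-identityˡ _ ⟩
      extensions p n j i ∎
      where
      open ≡-Reasoning
      X : ℕ
      X = extensions p k j i
      Contains⇔Indep : ∀ S → indicator (Contains? S base) ≡ indicator (Within.Indep? S base)
      Contains⇔Indep S = indicator-cong _ _ ((λ all → indep , all) , proj₂)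
      one-subspace-if-independent : (us : Vec (𝔽ⁿ n) (i + j)) →
        count (λ S → Within.Indep? S us) subspaces ≡ indicator (FullSpace.Indep? n us)
      one-subspace-if-independent us with FullSpace.Indep? n us
      ... | yes (indep′ , _) = trans (count-cong _ (λ S → Contains? S us) subspaces (λ S _ → proj₂ , (λ all → indep′ , all)))
                                     (count-Contains-independent i+j≡k us indep′)
      ... | no ¬indep        = count-none _ subspaces λ S _ (indep′ , _) → ¬indep (indep′ , VecAll.universal (λ _ → tt) us)

  module Incidence {n′ k′ : ℕ} (ws : List (𝔽ⁿ (suc n′) → Set)) (enum : EnumSubspaces p (suc n′) (suc k′) ws) where

    open Enumeration ws enum public

    count-∋ : ∀ x → count (_∋? x) subspaces ≡ gaussian p n′ k′ + indicator (x ≟ⁿ 𝟎 _) * (p ^ suc k′ * gaussian p n′ (suc k′))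
    count-∋ x with x ≟ⁿ 𝟎 _
    ... | yes refl = begin
      count (_∋? 𝟎 _) subspaces                       ≡⟨ count-all _ subspaces (λ (_ , _ , _ , W⇔Span) _ → proj₂ (W⇔Span (𝟎 _)) (Span-𝟎 _)) ⟩
      length subspaces                               ≡⟨ gaussian-unique 1<p _ (suc n′) (suc k′) 0 all-subspaces ⟩
      gaussian p (suc n′) (suc k′)                   ≡⟨ cong (gaussian p n′ k′ +_) (sym (ℕₚ.*-identityˡ _)) ⟩
      gaussian p n′ k′ + 1 * (p ^ suc k′ * gaussian p n′ (suc k′)) ∎
      where
      open ≡-Reasoning
      all-subspaces : length subspaces * extensions p (suc k′) 0 (suc k′) ≡ extensions p (suc n′) 0 (suc k′)
      all-subspaces = trans (cong (_* extensions p (suc k′) 0 (suc k′)) (sym (count-all (λ S → Contains? S []) subspaces (λ _ _ → VecAll.[]))))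
                            (count-Contains [] (suc k′) (ℕₚ.+-identityʳ _) LinIndep-[])
    ... | no x≢0 = begin
      count (_∋? x) subspaces                        ≡⟨ gaussian-unique 1<p _ n′ k′ 1 through-x ⟩
      gaussian p n′ k′                               ≡⟨ sym (ℕₚ.+-identityʳ _) ⟩
      gaussian p n′ k′ + 0 * (p ^ suc k′ * gaussian p n′ (suc k′)) ∎
      where
      open ≡-Reasoning
      through-x : count (_∋? x) subspaces * extensions p (suc k′) 1 k′ ≡ extensions p (suc n′) 1 k′
      through-x = trans (cong (_* extensions p (suc k′) 1 k′) (count-cong _ (λ S → Contains? S (x ∷ [])) subspaces
                                                                  (λ S _ → (VecAll._∷ VecAll.[]) , VecAll.head)))
                        (count-Contains (x ∷ []) k′ (ℕₚ.+-comm k′ 1) (LinIndep-[ x ] x≢0))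

    count-∋-∩ : {U : 𝔽ⁿ (suc n′) → Set} (U? : ∀ x → Dec (U x)) → ∀ x →
                count (λ S → S ∋? x ×-dec U? x) subspaces
                ≡ indicator (U? x) * gaussian p n′ k′ + indicator (U? x ×-dec x ≟ⁿ 𝟎 _) * (p ^ suc k′ * gaussian p n′ (suc k′))
    count-∋-∩ U? x with U? x
    ... | no x∉U  = count-none _ subspaces λ _ _ (_ , x∈U) → x∉U x∈U
    ... | yes x∈U = begin
      count (λ S → S ∋? x ×-dec yes x∈U) subspaces            ≡⟨ count-cong _ (_∋? x) subspaces (λ _ _ → proj₁ , (_, x∈U)) ⟩
      count (_∋? x) subspaces                                 ≡⟨ count-∋ x ⟩
      a + indicator (x ≟ⁿ 𝟎 _) * b                            ≡⟨ cong₂ _+_ (sym (ℕₚ.+-identityʳ a))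
                                                                   (cong (_* b) (trans (sym (ℕₚ.*-identityˡ _)) (indicator-× (yes x∈U) (x ≟ⁿ 𝟎 _)))) ⟩
      1 * a + indicator (yes x∈U ×-dec x ≟ⁿ 𝟎 _) * b          ∎
      where
      open ≡-Reasoning
      a b : ℕ
      a = gaussian p n′ k′
      b = p ^ suc k′ * gaussian p n′ (suc k′)

  module _ {U : 𝔽ⁿ n → Set} (U? : ∀ x → Dec (U x)) where

    sum-p^dim-∩ : (ws : List (𝔽ⁿ n → Set)) (dims : All (λ W → HasDim p W k) ws) (ds : List ℕ) →
                  Pointwise (λ W d → HasDim p (_∩_ p W U) d) ws ds →
                  sumℕ (map (p ^_) ds) ≡ ∑ (λ S → count (λ x → S ∋? x ×-dec U? x) (all𝔽ⁿ n)) (All.toList dims)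
    sum-p^dim-∩ []       All.[]         []       []                 = refl
    sum-p^dim-∩ (W ∷ ws) (_ All.∷ dims) (d ∷ ds) (dim∩ ∷ dims∩) = cong₂ _+_
      (trans (sym (count-HasDim dim∩)) (count-cong _ _ (all𝔽ⁿ n) (λ _ _ → (λ w∩u → w∩u) , (λ w∩u → w∩u))))
      (sum-p^dim-∩ ws dims ds dims∩)

  ν-formula : ∀ {n′ k′ l} {U : 𝔽ⁿ (suc n′) → Set} → HasDim p U l → ∀ {ν} → NuValue p (suc n′) (suc k′) U ν →
              ν ≡ p ^ l * gaussian p n′ k′ + p ^ suc k′ * gaussian p n′ (suc k′)
  ν-formula {n′} {k′} {l} {U} dimU (ws , enum , ds , dims∩ , refl) = begin
    sumℕ (map (p ^_) ds)
      ≡⟨ sum-p^dim-∩ U? ws (proj₁ enum) ds dims∩ ⟩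
    ∑ (λ S → count (λ x → S ∋? x ×-dec U? x) (all𝔽ⁿ (suc n′))) subspaces
      ≡⟨ ∑-swap (λ S x → indicator (S ∋? x ×-dec U? x)) subspaces (all𝔽ⁿ (suc n′)) ⟩
    ∑ (λ x → count (λ S → S ∋? x ×-dec U? x) subspaces) (all𝔽ⁿ (suc n′))
      ≡⟨ ∑-cong _ _ (all𝔽ⁿ (suc n′)) (λ x _ → count-∋-∩ U? x) ⟩
    ∑ (λ x → indicator (U? x) * a + indicator (U? x ×-dec x ≟ⁿ 𝟎 (suc n′)) * b) (all𝔽ⁿ (suc n′))
      ≡⟨ ∑-+ _ _ (all𝔽ⁿ (suc n′)) ⟩
    ∑ (λ x → indicator (U? x) * a) (all𝔽ⁿ (suc n′)) + ∑ (λ x → indicator (U? x ×-dec x ≟ⁿ 𝟎 (suc n′)) * b) (all𝔽ⁿ (suc n′))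
      ≡⟨ cong₂ _+_ (∑-*ʳ a _ (all𝔽ⁿ (suc n′))) (∑-*ʳ b _ (all𝔽ⁿ (suc n′))) ⟩
    a * count U? (all𝔽ⁿ (suc n′)) + b * count (λ x → U? x ×-dec x ≟ⁿ 𝟎 (suc n′)) (all𝔽ⁿ (suc n′))
      ≡⟨ cong₂ (λ u v → a * u + b * v) (count-HasDim dimU) (count-HasDim-𝟎 dimU) ⟩
    a * p ^ l + b * 1
      ≡⟨ cong₂ _+_ (ℕₚ.*-comm a (p ^ l)) (ℕₚ.*-identityʳ b) ⟩
    p ^ l * a + b ∎
    where
    open ≡-Reasoning
    open Incidence ws enum
    a b : ℕ
    a = gaussian p n′ k′
    b = p ^ suc k′ * gaussian p n′ (suc k′)
    U? : ∀ x → Dec (U x)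
    U? = HasDim⇒Dec dimU

  ν-formula-complement : ∀ {n′ k′ l} → suc k′ ≤ n′ → ∀ {U : 𝔽ⁿ (suc n′) → Set} → HasDim p U l →
                         ∀ {ν} → NuValue p (suc n′) (n′ ∸ k′) U ν →
                         ν ≡ p ^ l * gaussian p n′ (suc k′) + p ^ (n′ ∸ k′) * gaussian p n′ k′
  ν-formula-complement {n′} {k′} {l} k<n′ {U} dimU {ν} ν-value = begin
    ν                                                             ≡⟨ ν-formula dimU (subst (λ d → NuValue p (suc n′) d U ν) n′∸k′≡1+m ν-value) ⟩
    p ^ l * gaussian p n′ m + p ^ suc m * gaussian p n′ (suc m)   ≡⟨ cong₂ (λ u v → p ^ l * u + v) gaussian-m
                                                                       (cong₂ _*_ (cong (p ^_) (sym n′∸k′≡1+m)) gaussian-1+m) ⟩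
    p ^ l * gaussian p n′ (suc k′) + p ^ (n′ ∸ k′) * gaussian p n′ k′ ∎
    where
    open ≡-Reasoning
    m : ℕ
    m = n′ ∸ suc k′
    n′∸k′≡1+m : n′ ∸ k′ ≡ suc m
    n′∸k′≡1+m = ℕₚ.+-∸-assoc 1 k<n′
    gaussian-m : gaussian p n′ m ≡ gaussian p n′ (suc k′)
    gaussian-m = trans (gaussian-sym 1<p n′ m (ℕₚ.m∸n≤m n′ (suc k′))) (cong (gaussian p n′) (ℕₚ.m∸[m∸n]≡n k<n′))
    gaussian-1+m : gaussian p n′ (suc m) ≡ gaussian p n′ k′
    gaussian-1+m = begin
      gaussian p n′ (suc m)           ≡⟨ cong (gaussian p n′) (sym n′∸k′≡1+m) ⟩
      gaussian p n′ (n′ ∸ k′)         ≡⟨ sym (gaussian-sym 1<p n′ k′ (ℕₚ.≤-trans (ℕₚ.n≤1+n k′) k<n′)) ⟩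
      gaussian p n′ k′                ∎

  ν-duality : ∀ {n′ k′ l} → suc k′ < suc n′ → l ≤ suc n′ →
              ∀ {U U′ : 𝔽ⁿ (suc n′) → Set} → HasDim p U l → HasDim p U′ (suc n′ ∸ l) →
              ∀ {ν ν′} → NuValue p (suc n′) (suc k′) U ν → NuValue p (suc n′) (suc n′ ∸ suc k′) U′ ν′ →
              ν * p ^ suc n′ ≡ ν′ * p ^ (suc k′ + l)
  ν-duality {n′} {k′} {l} (s≤s k<n′) l≤n dimU dimU′ {ν} {ν′} ν-value ν′-value = begin
    ν * p ^ suc n′
      ≡⟨ cong (_* p ^ suc n′) (ν-formula dimU ν-value) ⟩
    (p ^ l * a + p ^ suc k′ * b) * p ^ suc n′
      ≡⟨ solve 5 (λ a b x y z → (x :* a :+ y :* b) :* z := (y :* z) :* b :+ (x :* z) :* a) refl a b (p ^ l) (p ^ suc k′) (p ^ suc n′) ⟩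
    (p ^ suc k′ * p ^ suc n′) * b + (p ^ l * p ^ suc n′) * a
      ≡⟨ cong₂ (λ u v → u * b + v * a) (sym (^[n∸l]*^[k+l]≡^k*^n p (suc k′) l≤n))
               (sym (trans (cong (λ e → p ^ (n′ ∸ k′) * p ^ e) (ℕₚ.+-comm (suc k′) l)) (^[n∸l]*^[k+l]≡^k*^n p l (ℕₚ.<⇒≤ (s≤s k<n′))))) ⟩
    (p ^ (suc n′ ∸ l) * p ^ (suc k′ + l)) * b + (p ^ (n′ ∸ k′) * p ^ (suc k′ + l)) * a
      ≡⟨ solve 5 (λ a b x y z → (x :* z) :* b :+ (y :* z) :* a := (x :* b :+ y :* a) :* z) refl a b (p ^ (suc n′ ∸ l)) (p ^ (n′ ∸ k′)) (p ^ (suc k′ + l)) ⟩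
    (p ^ (suc n′ ∸ l) * b + p ^ (n′ ∸ k′) * a) * p ^ (suc k′ + l)
      ≡⟨ cong (_* p ^ (suc k′ + l)) (sym (ν-formula-complement k<n′ dimU′ ν′-value)) ⟩
    ν′ * p ^ (suc k′ + l) ∎
    where
    open ≡-Reasoning
    open +-*-Solver
    a b : ℕ
    a = gaussian p n′ k′
    b = gaussian p n′ (suc k′)

module IntegersAndRationals where

  open Data.Integer using (+_)

  remainder-unique : ∀ {d} .{{_ : NonZero d}} {r i : ℕ} (q y : ℤ) → r < d → i < d →
                     + r ℤ.+ q ℤ.* + d ≡ + i ℤ.+ y ℤ.* + d → r ≡ i
  remainder-unique {d} {r} {i} q y r<d i<d eq = ℤₚ.+-injective (ℤₚ.i-j≡0⇒i≡j (+ r) (+ i) (ℤₚ.∣i∣≡0⇒i≡0 ∣r-i∣≡0))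
    where
    open ℤSolver.+-*-Solver
    r-i≡[y-q]*d : + r ℤ.- + i ≡ (y ℤ.- q) ℤ.* + d
    r-i≡[y-q]*d = begin
      + r ℤ.- + i                                 ≡⟨ solve 3 (λ r i m → r :- i := (r :+ m) :- (i :+ m)) refl (+ r) (+ i) (q ℤ.* + d) ⟩
      (+ r ℤ.+ q ℤ.* + d) ℤ.- (+ i ℤ.+ q ℤ.* + d) ≡⟨ cong (ℤ._- (+ i ℤ.+ q ℤ.* + d)) eq ⟩
      (+ i ℤ.+ y ℤ.* + d) ℤ.- (+ i ℤ.+ q ℤ.* + d) ≡⟨ solve 4 (λ i y q d → (i :+ y :* d) :- (i :+ q :* d) := (y :- q) :* d) refl (+ i) y q (+ d) ⟩
      (y ℤ.- q) ℤ.* + d                           ∎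
      where open ≡-Reasoning
    ∣r-i∣<d : ∣ + r ℤ.- + i ∣ < d
    ∣r-i∣<d = subst (λ z → ∣ z ∣ < d) (sym (ℤₚ.m-n≡m⊖n r i)) (ℕₚ.≤-<-trans (ℤₚ.∣m⊝n∣≤m⊔n r i) (ℕₚ.⊔-pres-<m r<d i<d))
    ∣r-i∣≡0 : ∣ + r ℤ.- + i ∣ ≡ 0
    ∣r-i∣≡0 with ∣ y ℤ.- q ∣ | trans (cong ∣_∣ r-i≡[y-q]*d) (ℤₚ.abs-* (y ℤ.- q) (+ d))
    ... | zero  | ∣r-i∣≡0 = ∣r-i∣≡0
    ... | suc k | ∣r-i∣≡d+k*d = ⊥-elim (ℕₚ.<⇒≱ ∣r-i∣<d (subst (d ≤_) (sym ∣r-i∣≡d+k*d) (ℕₚ.m≤m+n d (k * d))))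

  private
    toℚᵘ-/ : ∀ a b → ℚ.toℚᵘ (a / suc b) ℚᵘ.≃ mkℚᵘ a b
    toℚᵘ-/ a b = ℚₚ.toℚᵘ-fromℚᵘ (mkℚᵘ a b)

  /-≡ : ∀ a b c d .{{_ : NonZero b}} .{{_ : NonZero d}} → a ℤ.* + d ≡ c ℤ.* + b → a / b ≡ c / d
  /-≡ a (suc b) c (suc d) eq =
    ℚₚ.toℚᵘ-injective (ℚᵘₚ.≃-trans (toℚᵘ-/ a b) (ℚᵘₚ.≃-trans (*≡* eq) (ℚᵘₚ.≃-sym (toℚᵘ-/ c d))))

  /-* : ∀ a b c d → (a / suc b) ℚ.* (c / suc d) ≡ (a ℤ.* c) / (suc b * suc d)
  /-* a b c d = ℚₚ.toℚᵘ-injective (ℚᵘₚ.≃-trans (ℚₚ.toℚᵘ-homo-* (a / suc b) (c / suc d))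
    (ℚᵘₚ.≃-trans (ℚᵘₚ.*-cong (toℚᵘ-/ a b) (toℚᵘ-/ c d)) (ℚᵘₚ.≃-sym (toℚᵘ-/ _ (d + b * suc d)))))

  /-+ : ∀ a b c d → a / suc b ℚ.+ c / suc d ≡ (a ℤ.* + suc d ℤ.+ c ℤ.* + suc b) / (suc b * suc d)
  /-+ a b c d = ℚₚ.toℚᵘ-injective (ℚᵘₚ.≃-trans (ℚₚ.toℚᵘ-homo-+ (a / suc b) (c / suc d))
    (ℚᵘₚ.≃-trans (ℚᵘₚ.+-cong (toℚᵘ-/ a b) (toℚᵘ-/ c d)) (ℚᵘₚ.≃-sym (toℚᵘ-/ _ (d + b * suc d)))))

  ℤtoℚ-+ : ∀ a b → ℤtoℚ (a ℤ.+ b) ≡ ℤtoℚ a ℚ.+ ℤtoℚ b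
  ℤtoℚ-+ a b = sym (trans (/-+ a 0 b 0) (/-≡ (a ℤ.* + 1 ℤ.+ b ℤ.* + 1) 1 (a ℤ.+ b) 1
    (solve 2 (λ a b → (a :* con (+ 1) :+ b :* con (+ 1)) :* con (+ 1) := (a :+ b) :* con (+ 1)) refl a b)))
    where open ℤSolver.+-*-Solver

  ℤtoℚ-* : ∀ a b → ℤtoℚ (a ℤ.* b) ≡ ℤtoℚ a ℚ.* ℤtoℚ b
  ℤtoℚ-* a b = sym (/-* a 0 b 0)

  ℕtoℚ-+ : ∀ m n → ℕtoℚ (m + n) ≡ ℕtoℚ m ℚ.+ ℕtoℚ n
  ℕtoℚ-+ m n = trans (cong ℤtoℚ (ℤₚ.pos-+ m n)) (ℤtoℚ-+ (+ m) (+ n))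

  ℕtoℚ-* : ∀ m n → ℕtoℚ (m * n) ≡ ℕtoℚ m ℚ.* ℕtoℚ n
  ℕtoℚ-* m n = trans (cong ℤtoℚ (ℤₚ.pos-* m n)) (ℤtoℚ-* (+ m) (+ n))

  ↥-ℤtoℚ : ∀ z → ↥ (ℤtoℚ z) ≡ z
  ↥-ℤtoℚ z = trans (sym (ℤₚ.*-identityʳ _)) (trans (cong (↥ (ℤtoℚ z) ℤ.*_) (sym (ℤGCD.gcd-zeroʳ z))) (ℚₚ.↥-/ z 1))

  ℕtoℚ-inverseˡ : ∀ m .{{_ : NonZero m}} → (+ 1 / m) ℚ.* ℕtoℚ m ≡ 1ℚ
  ℕtoℚ-inverseˡ (suc m) = trans (/-* (+ 1) m (+ suc m) 0) (/-≡ (+ 1 ℤ.* + suc m) (suc m * 1) (+ 1) 1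
    (trans (ℤₚ.*-identityʳ _) (cong (λ k → + 1 ℤ.* + k) (sym (ℕₚ.*-identityʳ (suc m))))))

  /≡*1/ : ∀ a m .{{_ : NonZero m}} → a / m ≡ ℤtoℚ a ℚ.* (+ 1 / m)
  /≡*1/ a (suc m) = sym (trans (/-* a 0 (+ 1) m) (/-≡ (a ℤ.* + 1) (1 * suc m) a (suc m)
    (cong₂ ℤ._*_ (ℤₚ.*-identityʳ a) (cong +_ (sym (ℕₚ.*-identityˡ (suc m)))))))

  ℕtoℚ-suc-cancelˡ : ∀ m y → ℕtoℚ (suc m) ℚ.* y ≡ 0ℚ → y ≡ 0ℚ
  ℕtoℚ-suc-cancelˡ m y eq = begin
    y                                         ≡⟨ sym (ℚₚ.*-identityˡ y) ⟩
    1ℚ ℚ.* y                                  ≡⟨ cong (ℚ._* y) (sym (ℕtoℚ-inverseˡ (suc m))) ⟩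
    + 1 / suc m ℚ.* ℕtoℚ (suc m) ℚ.* y        ≡⟨ ℚₚ.*-assoc (+ 1 / suc m) _ y ⟩
    + 1 / suc m ℚ.* (ℕtoℚ (suc m) ℚ.* y)      ≡⟨ cong (+ 1 / suc m ℚ.*_) eq ⟩
    + 1 / suc m ℚ.* 0ℚ                        ≡⟨ ℚₚ.*-zeroʳ (+ 1 / suc m) ⟩
    0ℚ                                        ∎
    where open ≡-Reasoning

module Polynomials where

  open IntegersAndRationals
  open ℚSolver.+-*-Solver

  infixl 6 _+ᴾ_
  infixr 7 _·ᴾ_

  _+ᴾ_ : Poly → Poly → Poly
  []      +ᴾ g       = g
  (c ∷ f) +ᴾ []      = c ∷ f
  (c ∷ f) +ᴾ (d ∷ g) = (c ℚ.+ d) ∷ (f +ᴾ g)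

  _·ᴾ_ : ℚ → Poly → Poly
  c ·ᴾ f = map (c ℚ.*_) f

  dilate : ℕ → Poly → Poly
  dilate m []      = []
  dilate m (c ∷ f) = c ∷ ℕtoℚ m ·ᴾ dilate m f

  eval-+ᴾ : ∀ f g t → eval (f +ᴾ g) t ≡ eval f t ℚ.+ eval g t
  eval-+ᴾ []      g       t = sym (ℚₚ.+-identityˡ _)
  eval-+ᴾ (c ∷ f) []      t = sym (ℚₚ.+-identityʳ _)
  eval-+ᴾ (c ∷ f) (d ∷ g) t rewrite eval-+ᴾ f g t =
    solve 5 (λ c d t F G → (c :+ d) :+ t :* (F :+ G) := (c :+ t :* F) :+ (d :+ t :* G)) refl c d t (eval f t) (eval g t)

  coeff-+ᴾ : ∀ f g l → coeff (f +ᴾ g) l ≡ coeff f l ℚ.+ coeff g l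
  coeff-+ᴾ []      g       l       = sym (ℚₚ.+-identityˡ _)
  coeff-+ᴾ (c ∷ f) []      zero    = sym (ℚₚ.+-identityʳ _)
  coeff-+ᴾ (c ∷ f) []      (suc l) = sym (ℚₚ.+-identityʳ _)
  coeff-+ᴾ (c ∷ f) (d ∷ g) zero    = refl
  coeff-+ᴾ (c ∷ f) (d ∷ g) (suc l) = coeff-+ᴾ f g l

  eval-·ᴾ : ∀ c f t → eval (c ·ᴾ f) t ≡ c ℚ.* eval f t
  eval-·ᴾ c []      t = sym (ℚₚ.*-zeroʳ c)
  eval-·ᴾ c (x ∷ f) t rewrite eval-·ᴾ c f t =
    solve 4 (λ c x t F → c :* x :+ t :* (c :* F) := c :* (x :+ t :* F)) refl c x t (eval f t)

  coeff-·ᴾ : ∀ c f l → coeff (c ·ᴾ f) l ≡ c ℚ.* coeff f l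
  coeff-·ᴾ c []      l       = sym (ℚₚ.*-zeroʳ c)
  coeff-·ᴾ c (x ∷ f) zero    = refl
  coeff-·ᴾ c (x ∷ f) (suc l) = coeff-·ᴾ c f l

  eval-dilate : ∀ m f t → eval (dilate m f) t ≡ eval f (ℕtoℚ m ℚ.* t)
  eval-dilate m []      t = refl
  eval-dilate m (c ∷ f) t rewrite eval-·ᴾ (ℕtoℚ m) (dilate m f) t | eval-dilate m f t =
    solve 4 (λ c t m F → c :+ t :* (m :* F) := c :+ (m :* t) :* F) refl c t (ℕtoℚ m) (eval f (ℕtoℚ m ℚ.* t))

  coeff-dilate : ∀ m f l → coeff (dilate m f) l ≡ ℕtoℚ (m ^ l) ℚ.* coeff f l
  coeff-dilate m []      l       = sym (ℚₚ.*-zeroʳ (ℕtoℚ (m ^ l)))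
  coeff-dilate m (c ∷ f) zero    = sym (ℚₚ.*-identityˡ c)
  coeff-dilate m (c ∷ f) (suc l) = begin
    coeff (ℕtoℚ m ·ᴾ dilate m f) l               ≡⟨ coeff-·ᴾ (ℕtoℚ m) (dilate m f) l ⟩
    ℕtoℚ m ℚ.* coeff (dilate m f) l              ≡⟨ cong (ℕtoℚ m ℚ.*_) (coeff-dilate m f l) ⟩
    ℕtoℚ m ℚ.* (ℕtoℚ (m ^ l) ℚ.* coeff f l)      ≡⟨ sym (ℚₚ.*-assoc (ℕtoℚ m) _ _) ⟩
    ℕtoℚ m ℚ.* ℕtoℚ (m ^ l) ℚ.* coeff f l        ≡⟨ cong (ℚ._* coeff f l) (sym (ℕtoℚ-* m (m ^ l))) ⟩
    ℕtoℚ (m ^ suc l) ℚ.* coeff f l               ∎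
    where open ≡-Reasoning

  eval-·dilate+· : ∀ a b m f t →
    eval (ℕtoℚ a ·ᴾ dilate m f +ᴾ ℕtoℚ b ·ᴾ f) t ≡ ℕtoℚ a ℚ.* eval f (ℕtoℚ m ℚ.* t) ℚ.+ ℕtoℚ b ℚ.* eval f t
  eval-·dilate+· a b m f t = begin
    eval (ℕtoℚ a ·ᴾ dilate m f +ᴾ ℕtoℚ b ·ᴾ f) t                      ≡⟨ eval-+ᴾ (ℕtoℚ a ·ᴾ dilate m f) _ t ⟩
    eval (ℕtoℚ a ·ᴾ dilate m f) t ℚ.+ eval (ℕtoℚ b ·ᴾ f) t           ≡⟨ cong₂ ℚ._+_ (eval-·ᴾ (ℕtoℚ a) (dilate m f) t) (eval-·ᴾ (ℕtoℚ b) f t) ⟩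
    ℕtoℚ a ℚ.* eval (dilate m f) t ℚ.+ ℕtoℚ b ℚ.* eval f t           ≡⟨ cong (λ x → ℕtoℚ a ℚ.* x ℚ.+ ℕtoℚ b ℚ.* eval f t) (eval-dilate m f t) ⟩
    ℕtoℚ a ℚ.* eval f (ℕtoℚ m ℚ.* t) ℚ.+ ℕtoℚ b ℚ.* eval f t         ∎
    where open ≡-Reasoning

  coeff-·dilate+· : ∀ a b m f l → coeff (ℕtoℚ a ·ᴾ dilate m f +ᴾ ℕtoℚ b ·ᴾ f) l ≡ ℕtoℚ (m ^ l * a + b) ℚ.* coeff f l
  coeff-·dilate+· a b m f l = begin
    coeff (ℕtoℚ a ·ᴾ dilate m f +ᴾ ℕtoℚ b ·ᴾ f) l                   ≡⟨ coeff-+ᴾ (ℕtoℚ a ·ᴾ dilate m f) _ l ⟩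
    coeff (ℕtoℚ a ·ᴾ dilate m f) l ℚ.+ coeff (ℕtoℚ b ·ᴾ f) l        ≡⟨ cong₂ ℚ._+_ (coeff-·ᴾ (ℕtoℚ a) (dilate m f) l) (coeff-·ᴾ (ℕtoℚ b) f l) ⟩
    ℕtoℚ a ℚ.* coeff (dilate m f) l ℚ.+ ℕtoℚ b ℚ.* c               ≡⟨ cong (λ x → ℕtoℚ a ℚ.* x ℚ.+ ℕtoℚ b ℚ.* c) (coeff-dilate m f l) ⟩
    ℕtoℚ a ℚ.* (ℕtoℚ (m ^ l) ℚ.* c) ℚ.+ ℕtoℚ b ℚ.* c               ≡⟨ solve 4 (λ a M c b → a :* (M :* c) :+ b :* c := (M :* a :+ b) :* c) refl (ℕtoℚ a) (ℕtoℚ (m ^ l)) c (ℕtoℚ b) ⟩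
    (ℕtoℚ (m ^ l) ℚ.* ℕtoℚ a ℚ.+ ℕtoℚ b) ℚ.* c                     ≡⟨ cong (ℚ._* c) (sym (trans (ℕtoℚ-+ (m ^ l * a) b) (cong (ℚ._+ ℕtoℚ b) (ℕtoℚ-* (m ^ l) a)))) ⟩
    ℕtoℚ (m ^ l * a + b) ℚ.* c                                     ∎
    where
    open ≡-Reasoning
    c : ℚ
    c = coeff f l

  -- synthetic division by (t - a)
  quotient : ℚ → Poly → Poly
  quotient a []           = []
  quotient a (c ∷ [])     = []
  quotient a (c ∷ d ∷ f)  = eval (d ∷ f) a ∷ quotient a (d ∷ f)

  length-quotient : ∀ a c f → length (quotient a (c ∷ f)) ≡ length f
  length-quotient a c []      = refl
  length-quotient a c (d ∷ f) = cong suc (length-quotient a d f)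

  eval-quotient : ∀ a f t → eval f t ≡ (t ℚ.- a) ℚ.* eval (quotient a f) t ℚ.+ eval f a
  eval-quotient a []          t = solve 2 (λ t a → con 0ℚ := (t :- a) :* con 0ℚ :+ con 0ℚ) refl t a
  eval-quotient a (c ∷ [])    t = solve 3 (λ c t a → c :+ t :* con 0ℚ := (t :- a) :* con 0ℚ :+ (c :+ a :* con 0ℚ)) refl c t a
  eval-quotient a (c ∷ d ∷ f) t rewrite eval-quotient a (d ∷ f) t =
    solve 5 (λ c t a Q F → c :+ t :* ((t :- a) :* Q :+ F) := (t :- a) :* (F :+ t :* Q) :+ (c :+ a :* F)) refl
      c t a (eval (quotient a (d ∷ f)) t) (eval (d ∷ f) a)

  root∧quotient≡0⇒≡0 : ∀ a f → eval f a ≡ 0ℚ → (∀ l → coeff (quotient a f) l ≡ 0ℚ) → ∀ l → coeff f l ≡ 0ℚ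
  root∧quotient≡0⇒≡0 a []          _    _ l       = refl
  root∧quotient≡0⇒≡0 a (c ∷ [])    f[a]≡0 _ zero    = trans (solve 2 (λ c a → c := c :+ a :* con 0ℚ) refl c a) f[a]≡0
  root∧quotient≡0⇒≡0 a (c ∷ [])    _    _ (suc l) = refl
  root∧quotient≡0⇒≡0 a (c ∷ d ∷ f) f[a]≡0 q≡0 zero =
    trans (solve 2 (λ c a → c := c :+ a :* con 0ℚ) refl c a) (trans (cong (λ x → c ℚ.+ a ℚ.* x) (sym (q≡0 zero))) f[a]≡0)
  root∧quotient≡0⇒≡0 a (c ∷ d ∷ f) _    q≡0 (suc l) = root∧quotient≡0⇒≡0 a (d ∷ f) (q≡0 zero) (λ l → q≡0 (suc l)) l

  -- induction on the length: dividing out the root s leaves a polynomial vanishing from s + 1 on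
  vanishes-from⇒coeff≡0 : ∀ m f → length f ≤ m → ∀ s → (∀ t → eval f (ℕtoℚ (s + t)) ≡ 0ℚ) → ∀ l → coeff f l ≡ 0ℚ
  vanishes-from⇒coeff≡0 m       []      _         s _         l = refl
  vanishes-from⇒coeff≡0 (suc m) (c ∷ f) (s≤s f≤m) s vanishes =
    root∧quotient≡0⇒≡0 a (c ∷ f) f[a]≡0
      (vanishes-from⇒coeff≡0 m (quotient a (c ∷ f)) (subst (_≤ m) (sym (length-quotient a c f)) f≤m) (suc s) q-vanishes)
    where
    a : ℚ
    a = ℕtoℚ s
    f[a]≡0 : eval (c ∷ f) a ≡ 0ℚ
    f[a]≡0 = trans (cong (λ x → eval (c ∷ f) (ℕtoℚ x)) (sym (ℕₚ.+-identityʳ s))) (vanishes 0)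
    q-vanishes : ∀ t → eval (quotient a (c ∷ f)) (ℕtoℚ (suc s + t)) ≡ 0ℚ
    q-vanishes t = ℕtoℚ-suc-cancelˡ t _ (begin
      ℕtoℚ (suc t) ℚ.* Q                            ≡⟨ cong (ℚ._* Q) (sym T-a≡1+t) ⟩
      (T ℚ.- a) ℚ.* Q                               ≡⟨ solve 2 (λ X Y → X := X :+ Y :- Y) refl ((T ℚ.- a) ℚ.* Q) (eval (c ∷ f) a) ⟩
      (T ℚ.- a) ℚ.* Q ℚ.+ eval (c ∷ f) a ℚ.- eval (c ∷ f) a
                                                    ≡⟨ cong₂ ℚ._-_ (sym (eval-quotient a (c ∷ f) T)) f[a]≡0 ⟩
      eval (c ∷ f) T ℚ.- 0ℚ                          ≡⟨ cong (ℚ._- 0ℚ) (trans (cong (λ x → eval (c ∷ f) (ℕtoℚ x)) (sym (ℕₚ.+-suc s t))) (vanishes (suc t))) ⟩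
      0ℚ ℚ.- 0ℚ                                      ≡⟨⟩
      0ℚ                                             ∎)
      where
      open ≡-Reasoning
      T Q : ℚ
      T = ℕtoℚ (suc s + t)
      Q = eval (quotient a (c ∷ f)) T
      T-a≡1+t : T ℚ.- a ≡ ℕtoℚ (suc t)
      T-a≡1+t = begin
        T ℚ.- a                            ≡⟨ cong (ℚ._- a) (trans (cong ℕtoℚ (sym (ℕₚ.+-suc s t))) (ℕtoℚ-+ s (suc t))) ⟩
        a ℚ.+ ℕtoℚ (suc t) ℚ.- a           ≡⟨ solve 2 (λ X Y → X :+ Y :- X := Y) refl a (ℕtoℚ (suc t)) ⟩
        ℕtoℚ (suc t)                       ∎

  agree-on-ℕ⇒coeff≡ : ∀ f g → (∀ t → eval f (ℕtoℚ t) ≡ eval g (ℕtoℚ t)) → ∀ l → coeff f l ≡ coeff g l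
  agree-on-ℕ⇒coeff≡ f g agree l = begin
    coeff f l                                           ≡⟨ solve 2 (λ x y → x := (x :+ con (ℚ.- 1ℚ) :* y) :+ y) refl (coeff f l) (coeff g l) ⟩
    coeff f l ℚ.+ ℚ.- 1ℚ ℚ.* coeff g l ℚ.+ coeff g l     ≡⟨ cong (ℚ._+ coeff g l) (sym (trans (coeff-+ᴾ f _ l) (cong (coeff f l ℚ.+_) (coeff-·ᴾ (ℚ.- 1ℚ) g l)))) ⟩
    coeff (f +ᴾ ℚ.- 1ℚ ·ᴾ g) l ℚ.+ coeff g l             ≡⟨ cong (ℚ._+ coeff g l) (vanishes-from⇒coeff≡0 _ (f +ᴾ ℚ.- 1ℚ ·ᴾ g) ℕₚ.≤-refl 0 difference-vanishes l) ⟩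
    0ℚ ℚ.+ coeff g l                                     ≡⟨ ℚₚ.+-identityˡ _ ⟩
    coeff g l                                            ∎
    where
    open ≡-Reasoning
    difference-vanishes : ∀ t → eval (f +ᴾ ℚ.- 1ℚ ·ᴾ g) (ℕtoℚ t) ≡ 0ℚ
    difference-vanishes t = begin
      eval (f +ᴾ ℚ.- 1ℚ ·ᴾ g) (ℕtoℚ t)                        ≡⟨ eval-+ᴾ f _ (ℕtoℚ t) ⟩
      eval f (ℕtoℚ t) ℚ.+ eval (ℚ.- 1ℚ ·ᴾ g) (ℕtoℚ t)        ≡⟨ cong₂ ℚ._+_ (agree t) (eval-·ᴾ (ℚ.- 1ℚ) g (ℕtoℚ t)) ⟩
      eval g (ℕtoℚ t) ℚ.+ ℚ.- 1ℚ ℚ.* eval g (ℕtoℚ t)          ≡⟨ solve 1 (λ x → x :+ con (ℚ.- 1ℚ) :* x := con 0ℚ) refl (eval g (ℕtoℚ t)) ⟩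
      0ℚ                                                     ∎

module Scaling where

  ·ᵥ-assoc : ∀ c d (v : Vec ℚ n) → c ·ᵥ (d ·ᵥ v) ≡ (c ℚ.* d) ·ᵥ v
  ·ᵥ-assoc c d []      = refl
  ·ᵥ-assoc c d (x ∷ v) = cong₂ _∷_ (sym (ℚₚ.*-assoc c d x)) (·ᵥ-assoc c d v)

  ·ᵥ-identityˡ : (v : Vec ℚ n) → 1ℚ ·ᵥ v ≡ v
  ·ᵥ-identityˡ []      = refl
  ·ᵥ-identityˡ (x ∷ v) = cong₂ _∷_ (ℚₚ.*-identityˡ x) (·ᵥ-identityˡ v)

  ·ᵥ-distribˡ-+ᵥ : ∀ c (u v : Vec ℚ n) → c ·ᵥ (u +ᵥ v) ≡ (c ·ᵥ u) +ᵥ (c ·ᵥ v)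
  ·ᵥ-distribˡ-+ᵥ c []      []      = refl
  ·ᵥ-distribˡ-+ᵥ c (x ∷ u) (y ∷ v) = cong₂ _∷_ (ℚₚ.*-distribˡ-+ c x y) (·ᵥ-distribˡ-+ᵥ c u v)

  ·ᵥ-zeroʳ : ∀ n c → c ·ᵥ Vec.replicate n 0ℚ ≡ Vec.replicate n 0ℚ
  ·ᵥ-zeroʳ zero    c = refl
  ·ᵥ-zeroʳ (suc n) c = cong₂ _∷_ (ℚₚ.*-zeroʳ c) (·ᵥ-zeroʳ n c)

  +ᵥ-identityʳ : (v : Vec ℚ n) → v +ᵥ Vec.replicate n 0ℚ ≡ v
  +ᵥ-identityʳ []      = refl
  +ᵥ-identityʳ (x ∷ v) = cong₂ _∷_ (ℚₚ.+-identityʳ x) (+ᵥ-identityʳ v)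

  combo-·ᵥ : ∀ c (λs : Vec ℚ d) (vs : Vec (Vec ℚ n) d) → combo (c ·ᵥ λs) vs ≡ c ·ᵥ combo λs vs
  combo-·ᵥ {n = n} c []       []       = sym (·ᵥ-zeroʳ n c)
  combo-·ᵥ c (λ₁ ∷ λs) (v ∷ vs) =
    trans (cong₂ _+ᵥ_ (sym (·ᵥ-assoc c λ₁ v)) (combo-·ᵥ c λs vs)) (sym (·ᵥ-distribˡ-+ᵥ c (λ₁ ·ᵥ v) _))

  sumℚ-·ᵥ : ∀ c (λs : Vec ℚ d) → sumℚ (c ·ᵥ λs) ≡ c ℚ.* sumℚ λs
  sumℚ-·ᵥ c []        = sym (ℚₚ.*-zeroʳ c)
  sumℚ-·ᵥ c (λ₁ ∷ λs) = trans (cong (c ℚ.* λ₁ ℚ.+_) (sumℚ-·ᵥ c λs)) (sym (ℚₚ.*-distribˡ-+ c λ₁ _))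

  ·ᵥ-nonNegative : ∀ c .{{_ : ℚ.NonNegative c}} (λs : Vec ℚ d) → VecAll.All (0ℚ ℚ.≤_) λs → VecAll.All (0ℚ ℚ.≤_) (c ·ᵥ λs)
  ·ᵥ-nonNegative c []        VecAll.[]          = VecAll.[]
  ·ᵥ-nonNegative c (λ₁ ∷ λs) (0≤λ₁ VecAll.∷ 0≤λs) =
    subst (ℚ._≤ c ℚ.* λ₁) (ℚₚ.*-zeroʳ c) (ℚₚ.*-monoˡ-≤-nonNeg c 0≤λ₁) VecAll.∷ ·ᵥ-nonNegative c λs 0≤λs

  InDilate-·ᵥ : ∀ {m} (vs : Vec (Vec ℤ n) m) c .{{_ : ℚ.NonNegative c}} t t′ → c ℚ.* ℕtoℚ t ≡ ℕtoℚ t′ →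
                ∀ {x} → InDilate vs t x → InDilate vs t′ (c ·ᵥ x)
  InDilate-·ᵥ vs c t t′ ct≡t′ (λs , 0≤λs , Σλ≡t , combo≡x) =
    c ·ᵥ λs , ·ᵥ-nonNegative c λs 0≤λs , trans (sumℚ-·ᵥ c λs) (trans (cong (c ℚ.*_) Σλ≡t) ct≡t′) ,
    trans (combo-·ᵥ c λs _) (cong (c ·ᵥ_) combo≡x)

-- The lattices between L = ℤⁿ and p⁻¹L

module Lattices (p : ℕ) .{{_ : NonZero p}} where

  open Data.Integer using (+_)
  open IntegersAndRationals
  open Scaling

  π ι : ℚ
  π = ℕtoℚ p
  ι = + 1 / p

  instance
    π-nonNeg : ℚ.NonNegative π
    π-nonNeg = ℚₚ.normalize-nonNeg p 1
    ι-nonNeg : ℚ.NonNegative ι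
    ι-nonNeg = ℚₚ.normalize-nonNeg 1 p

  ι*π≡1 : ι ℚ.* π ≡ 1ℚ
  ι*π≡1 = ℕtoℚ-inverseˡ p

  π*ι≡1 : π ℚ.* ι ≡ 1ℚ
  π*ι≡1 = trans (ℚₚ.*-comm π ι) ι*π≡1

  fractions : Vec (Fin p) n → Vec ℚ n
  fractions = Vec.map (λ i → (+ toℕ i) / p)

  -- the integer point p · (Y + w / p)
  lift : Vec ℤ n → Vec (Fin p) n → Vec ℤ n
  lift = Vec.zipWith (λ y i → + p ℤ.* y ℤ.+ + toℕ i)

  reduceℤ : ℤ → Fin p
  reduceℤ z = fromℕ< (n%ℕd<d z p)

  -- junk on non-integral points; only applied to points of L
  reduce : Vec ℚ n → Fpⁿ p n
  reduce = Vec.map (λ x → reduceℤ (↥ x))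

  toℕ-reduceℤ-↥ : ∀ z → toℕ (reduceℤ (↥ ℤtoℚ z)) ≡ z %ℕ p
  toℕ-reduceℤ-↥ z = trans (Finₚ.toℕ-fromℕ< _) (cong (_%ℕ p) (↥-ℤtoℚ z))

  π·lift : (Y : Vec ℤ n) (w : Vec (Fin p) n) → π ·ᵥ (ℤvec Y +ᵥ fractions w) ≡ ℤvec (lift Y w)
  π·lift []      []      = refl
  π·lift (y ∷ Y) (i ∷ w) = cong₂ _∷_ (begin
    π ℚ.* (ℤtoℚ y ℚ.+ (+ toℕ i) / p)                 ≡⟨ cong (λ x → π ℚ.* (ℤtoℚ y ℚ.+ x)) (/≡*1/ (+ toℕ i) p) ⟩
    π ℚ.* (ℤtoℚ y ℚ.+ I ℚ.* ι)                       ≡⟨ solve 4 (λ P Y I J → P :* (Y :+ I :* J) := P :* Y :+ (P :* J) :* I) refl π (ℤtoℚ y) I ι ⟩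
    π ℚ.* ℤtoℚ y ℚ.+ (π ℚ.* ι) ℚ.* I                 ≡⟨ cong (λ x → π ℚ.* ℤtoℚ y ℚ.+ x ℚ.* I) π*ι≡1 ⟩
    π ℚ.* ℤtoℚ y ℚ.+ 1ℚ ℚ.* I                        ≡⟨ cong (π ℚ.* ℤtoℚ y ℚ.+_) (ℚₚ.*-identityˡ I) ⟩
    π ℚ.* ℤtoℚ y ℚ.+ I                               ≡⟨ cong (ℚ._+ I) (sym (ℤtoℚ-* (+ p) y)) ⟩
    ℤtoℚ (+ p ℤ.* y) ℚ.+ I                           ≡⟨ sym (ℤtoℚ-+ (+ p ℤ.* y) (+ toℕ i)) ⟩
    ℤtoℚ (+ p ℤ.* y ℤ.+ + toℕ i)                     ∎) (π·lift Y w)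
    where
    open ≡-Reasoning
    open ℚSolver.+-*-Solver
    I : ℚ
    I = ℤtoℚ (+ toℕ i)

  reduce-lift : (Y : Vec ℤ n) (w : Vec (Fin p) n) → reduce (ℤvec (lift Y w)) ≡ w
  reduce-lift []      []      = refl
  reduce-lift (y ∷ Y) (i ∷ w) = cong₂ _∷_ (Finₚ.toℕ-injective (trans (toℕ-reduceℤ-↥ a)
    (remainder-unique (a /ℕ p) y (n%ℕd<d a p) (Finₚ.toℕ<n i) (trans (sym (a≡a%ℕn+[a/ℕn]*n a p)) a≡i+y*p))))
    (reduce-lift Y w)
    where
    a : ℤ
    a = + p ℤ.* y ℤ.+ + toℕ i
    a≡i+y*p : a ≡ + toℕ i ℤ.+ y ℤ.* + p
    a≡i+y*p = solve 3 (λ P y i → P :* y :+ i := i :+ y :* P) refl (+ p) y (+ toℕ i)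
      where open ℤSolver.+-*-Solver

  ι·ℤvec : (Z : Vec ℤ n) → ι ·ᵥ ℤvec Z ≡ ℤvec (Vec.map (_/ℕ p) Z) +ᵥ fractions (reduce (ℤvec Z))
  ι·ℤvec []      = refl
  ι·ℤvec (z ∷ Z) = cong₂ _∷_ (begin
    ι ℚ.* ℤtoℚ z                                       ≡⟨ cong (λ x → ι ℚ.* ℤtoℚ x) (a≡a%ℕn+[a/ℕn]*n z p) ⟩
    ι ℚ.* ℤtoℚ (+ r ℤ.+ q ℤ.* + p)                     ≡⟨ cong (ι ℚ.*_) (trans (ℤtoℚ-+ (+ r) (q ℤ.* + p)) (cong (ℤtoℚ (+ r) ℚ.+_) (ℤtoℚ-* q (+ p)))) ⟩
    ι ℚ.* (ℤtoℚ (+ r) ℚ.+ ℤtoℚ q ℚ.* π)                ≡⟨ solve 4 (λ I R Q P → I :* (R :+ Q :* P) := Q :* (I :* P) :+ R :* I) refl ι (ℤtoℚ (+ r)) (ℤtoℚ q) π ⟩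
    ℤtoℚ q ℚ.* (ι ℚ.* π) ℚ.+ ℤtoℚ (+ r) ℚ.* ι          ≡⟨ cong₂ ℚ._+_ (trans (cong (ℤtoℚ q ℚ.*_) ι*π≡1) (ℚₚ.*-identityʳ (ℤtoℚ q))) (sym (/≡*1/ (+ r) p)) ⟩
    ℤtoℚ q ℚ.+ (+ r) / p                               ≡⟨ cong (λ x → ℤtoℚ q ℚ.+ (+ x) / p) (sym (toℕ-reduceℤ-↥ z)) ⟩
    ℤtoℚ q ℚ.+ (+ toℕ (reduceℤ (↥ ℤtoℚ z))) / p        ∎) (ι·ℤvec Z)
    where
    open ≡-Reasoning
    open ℚSolver.+-*-Solver
    r : ℕ
    r = z %ℕ p
    q : ℤ
    q = z /ℕ p

  π·ι· : (z : Vec ℚ n) → π ·ᵥ (ι ·ᵥ z) ≡ z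
  π·ι· z = trans (·ᵥ-assoc π ι z) (trans (cong (_·ᵥ z) π*ι≡1) (·ᵥ-identityˡ z))

  π·-injective : {x y : Vec ℚ n} → π ·ᵥ x ≡ π ·ᵥ y → x ≡ y
  π·-injective {x = x} {y} eq = begin
    x                  ≡⟨ sym (ι·π· x) ⟩
    ι ·ᵥ (π ·ᵥ x)      ≡⟨ cong (ι ·ᵥ_) eq ⟩
    ι ·ᵥ (π ·ᵥ y)      ≡⟨ ι·π· y ⟩
    y                  ∎
    where
    open ≡-Reasoning
    ι·π· : (z : Vec ℚ n) → ι ·ᵥ (π ·ᵥ z) ≡ z
    ι·π· z = trans (·ᵥ-assoc ι π z) (trans (cong (_·ᵥ z) ι*π≡1) (·ᵥ-identityˡ z))

  π*t : ∀ t → π ℚ.* ℕtoℚ t ≡ ℕtoℚ (p * t)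
  π*t t = sym (ℕtoℚ-* p t)

  ι*pt : ∀ t → ι ℚ.* ℕtoℚ (p * t) ≡ ℕtoℚ t
  ι*pt t = begin
    ι ℚ.* ℕtoℚ (p * t)         ≡⟨ cong (ι ℚ.*_) (ℕtoℚ-* p t) ⟩
    ι ℚ.* (π ℚ.* ℕtoℚ t)       ≡⟨ sym (ℚₚ.*-assoc ι π _) ⟩
    ι ℚ.* π ℚ.* ℕtoℚ t         ≡⟨ cong (ℚ._* ℕtoℚ t) ι*π≡1 ⟩
    1ℚ ℚ.* ℕtoℚ t              ≡⟨ ℚₚ.*-identityˡ _ ⟩
    ℕtoℚ t                     ∎
    where open ≡-Reasoning

  -- x ↦ p x maps tP ∩ M bijectively onto the points of ptP ∩ L reducing into W
  length-tP∩M≡count-reduce : ∀ {m} (vs : Vec (Vec ℤ n) m) t (W : Fpⁿ p n → Set) (W? : ∀ w → Dec (W w))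
    (xs : List (Vec ℚ n)) → Unique xs → (∀ x → (x ∈ xs) ⇔ (InDilate vs (p * t) x × InL x)) →
    (ys : List (Vec ℚ n)) → Unique ys → (∀ y → (y ∈ ys) ⇔ (InDilate vs t y × InLattice p W y)) →
    length ys ≡ count (λ z → W? (reduce z)) xs
  length-tP∩M≡count-reduce vs t W W? xs xs-unique xs⇔ ys ys-unique ys⇔ = begin
    length ys                                   ≡⟨ sym (Listₚ.length-map (π ·ᵥ_) ys) ⟩
    length (map (π ·ᵥ_) ys)                     ≡⟨ Unique∧same-elements⇒length≡ (Uniqueₚ.map⁺ π·-injective ys-unique)
                                                     (Uniqueₚ.filter⁺ reduce∈W? xs-unique) same ⟩
    length (filter reduce∈W? xs)                ≡⟨ sym (count≡length-filter reduce∈W? xs) ⟩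
    count reduce∈W? xs                          ∎
    where
    open ≡-Reasoning
    reduce∈W? : ∀ z → Dec (W (reduce z))
    reduce∈W? z = W? (reduce z)
    into : ∀ {z} → z ∈ map (π ·ᵥ_) ys → z ∈ filter reduce∈W? xs
    into z∈ with ∈-map⁻ (π ·ᵥ_) z∈
    ... | y , y∈ , refl with proj₁ (ys⇔ y) y∈
    ... | y∈tP , (w , w∈W , Y , refl) = ∈-filter⁺ reduce∈W?
          (proj₂ (xs⇔ _) (InDilate-·ᵥ vs π t (p * t) (π*t t) y∈tP , lift Y w , π·lift Y w))
          (subst W (sym (trans (cong reduce (π·lift Y w)) (reduce-lift Y w))) w∈W)
    onto : ∀ {z} → z ∈ filter reduce∈W? xs → z ∈ map (π ·ᵥ_) ys
    onto {z} z∈ with ∈-filter⁻ reduce∈W? {xs = xs} z∈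
    ... | z∈xs , reduce-z∈W with proj₁ (xs⇔ z) z∈xs
    ... | z∈ptP , (Z , refl) = subst (_∈ map (π ·ᵥ_) ys) (π·ι· _)
          (∈-map⁺ (π ·ᵥ_) (proj₂ (ys⇔ _) (InDilate-·ᵥ vs ι (p * t) t (ι*pt t) z∈ptP ,
            (reduce (ℤvec Z) , reduce-z∈W , Vec.map (_/ℕ p) Z , ι·ℤvec Z))))
    same : ∀ z → (z ∈ map (π ·ᵥ_) ys) ⇔ (z ∈ filter reduce∈W? xs)
    same z = into , onto

  fractions-𝟎 : ∀ n → fractions (Vec.replicate n (0ₚ p)) ≡ Vec.replicate n 0ℚ
  fractions-𝟎 zero    = refl
  fractions-𝟎 (suc n) = cong₂ _∷_ (trans (cong (λ i → (+ i) / p) toℕ-0ₚ) (/-≡ (+ 0) p (+ 0) 1 refl)) (fractions-𝟎 n)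
    where
    toℕ-0ₚ : toℕ (0ₚ p) ≡ 0
    toℕ-0ₚ = trans (Finₚ.toℕ-fromℕ< _) (m<n⇒m%n≡m (ℕ.>-nonZero⁻¹ p))

  InLattice-𝟎⇔InL : ∀ {n} (x : Vec ℚ n) → InLattice p (_≡ Vec.replicate n (0ₚ p)) x ⇔ InL x
  InLattice-𝟎⇔InL {n} x =
      (λ { (_ , refl , Y , refl) → Y , ℤvec+0≡ℤvec Y })
    , (λ { (Y , refl) → Vec.replicate n (0ₚ p) , refl , Y , sym (ℤvec+0≡ℤvec Y) })
    where
    ℤvec+0≡ℤvec : (Y : Vec ℤ n) → ℤvec Y +ᵥ fractions (Vec.replicate n (0ₚ p)) ≡ ℤvec Y
    ℤvec+0≡ℤvec Y = trans (cong (ℤvec Y +ᵥ_) (fractions-𝟎 n)) (+ᵥ-identityʳ (ℤvec Y))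

-- The operator T(p, k) on Ehrhart polynomials

module HeckeOperator (p : ℕ) .{{_ : NonZero p}} (prime : Prime p) (n′ k′ : ℕ) {m : ℕ} (vs : Vec (Vec ℤ (suc n′)) m) where

  open Subspaces p prime
  open Lattices p
  open IntegersAndRationals
  open Polynomials

  a b : ℕ
  a = gaussian p n′ k′
  b = p ^ suc k′ * gaussian p n′ (suc k′)

  -- double counting the pairs (z, M) with z ∈ ptP ∩ L and z / p ∈ M
  T-count : ∀ t s → TValue p (suc k′) vs t s → ∀ c₁ c₂ →
            HasSize (λ x → InDilate vs t x × InL x) c₁ → HasSize (λ x → InDilate vs (p * t) x × InL x) c₂ →
            s ≡ a * c₂ + b * c₁
  T-count t s (ws , enum , cs , sizes , refl) c₁ c₂ (ys , ys-unique , ys⇔ , refl) (xs , xs-unique , xs⇔ , refl) = begin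
    sumℕ cs
      ≡⟨ sum-sizes ws (proj₁ enum) cs sizes ⟩
    ∑ (λ S → count (λ z → S ∋? reduce z) xs) subspaces
      ≡⟨ ∑-swap (λ S z → indicator (S ∋? reduce z)) subspaces xs ⟩
    ∑ (λ z → count (_∋? reduce z) subspaces) xs
      ≡⟨ ∑-cong _ _ xs (λ z _ → count-∋ (reduce z)) ⟩
    ∑ (λ z → a + indicator (reduce z ≟ⁿ 𝟎 _) * b) xs
      ≡⟨ ∑-+ (λ _ → a) _ xs ⟩
    ∑ (λ _ → a) xs + ∑ (λ z → indicator (reduce z ≟ⁿ 𝟎 _) * b) xs
      ≡⟨ cong₂ _+_ (∑-const a xs) (∑-*ʳ b _ xs) ⟩
    length xs * a + b * count (λ z → reduce z ≟ⁿ 𝟎 _) xs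
      ≡⟨ cong₂ (λ u v → u + b * v) (ℕₚ.*-comm (length xs) a) (sym lattice-points) ⟩
    a * length xs + b * length ys ∎
    where
    open ≡-Reasoning
    open Incidence ws enum
    lattice-points : length ys ≡ count (λ z → reduce z ≟ⁿ 𝟎 _) xs
    lattice-points = length-tP∩M≡count-reduce vs t _ (_≟ⁿ 𝟎 _) xs xs-unique xs⇔ ys ys-unique λ y →
      (λ y∈ → let y∈tP , y∈L = proj₁ (ys⇔ y) y∈ in y∈tP , proj₂ (InLattice-𝟎⇔InL y) y∈L) ,
      (λ (y∈tP , y∈M) → proj₂ (ys⇔ y) (y∈tP , proj₁ (InLattice-𝟎⇔InL y) y∈M))
    sum-sizes : (ws′ : List (𝔽ⁿ (suc n′) → Set)) (dims : All (λ W → HasDim p W (suc k′)) ws′) (cs′ : List ℕ) →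
                Pointwise (λ W c → HasSize (λ x → InDilate vs t x × InLattice p W x) c) ws′ cs′ →
                sumℕ cs′ ≡ ∑ (λ S → count (λ z → S ∋? reduce z) xs) (All.toList dims)
    sum-sizes []        All.[]          []        []                                   = refl
    sum-sizes (W ∷ ws′) (dim All.∷ dims) (c ∷ cs′) ((ysW , ysW-unique , ysW⇔ , refl) ∷ sizes′) = cong₂ _+_
      (length-tP∩M≡count-reduce vs t W (HasDim⇒Dec dim) xs xs-unique xs⇔ ysW ysW-unique ysW⇔)
      (sum-sizes ws′ dims cs′ sizes′)

  T-eval : ∀ E F → IsEhrhart vs E → IsTpkE p (suc k′) vs F →
           ∀ t → eval F (ℕtoℚ t) ≡ ℕtoℚ a ℚ.* eval E (ℕtoℚ (p * t)) ℚ.+ ℕtoℚ b ℚ.* eval E (ℕtoℚ t)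
  T-eval E F E-ehrhart F-T t with E-ehrhart t | E-ehrhart (p * t) | F-T t
  ... | c₁ , size₁ , E[t]≡c₁ | c₂ , size₂ , E[pt]≡c₂ | s , s-value , F[t]≡s = begin
    eval F (ℕtoℚ t)                                                   ≡⟨ F[t]≡s ⟩
    ℕtoℚ s                                                            ≡⟨ cong ℕtoℚ (T-count t s s-value c₁ c₂ size₁ size₂) ⟩
    ℕtoℚ (a * c₂ + b * c₁)                                            ≡⟨ trans (ℕtoℚ-+ (a * c₂) (b * c₁)) (cong₂ ℚ._+_ (ℕtoℚ-* a c₂) (ℕtoℚ-* b c₁)) ⟩
    ℕtoℚ a ℚ.* ℕtoℚ c₂ ℚ.+ ℕtoℚ b ℚ.* ℕtoℚ c₁                          ≡⟨ cong₂ (λ u v → ℕtoℚ a ℚ.* u ℚ.+ ℕtoℚ b ℚ.* v) (sym E[pt]≡c₂) (sym E[t]≡c₁) ⟩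
    ℕtoℚ a ℚ.* eval E (ℕtoℚ (p * t)) ℚ.+ ℕtoℚ b ℚ.* eval E (ℕtoℚ t)   ∎
    where open ≡-Reasoning

  T-coeff : ∀ l {U : 𝔽ⁿ (suc n′) → Set} → HasDim p U l → ∀ {ν} → NuValue p (suc n′) (suc k′) U ν →
            ∀ E F → IsEhrhart vs E → IsTpkE p (suc k′) vs F → coeff F l ≡ ℕtoℚ ν ℚ.* coeff E l
  T-coeff l dimU {ν} ν-value E F E-ehrhart F-T = begin
    coeff F l                                          ≡⟨ agree-on-ℕ⇒coeff≡ F G F≡G l ⟩
    coeff G l                                          ≡⟨ coeff-·dilate+· a b p E l ⟩
    ℕtoℚ (p ^ l * a + b) ℚ.* coeff E l                 ≡⟨ cong (λ x → ℕtoℚ x ℚ.* coeff E l) (sym (ν-formula dimU ν-value)) ⟩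
    ℕtoℚ ν ℚ.* coeff E l                               ∎
    where
    open ≡-Reasoning
    G : Poly
    G = ℕtoℚ a ·ᴾ dilate p E +ᴾ ℕtoℚ b ·ᴾ E
    F≡G : ∀ t → eval F (ℕtoℚ t) ≡ eval G (ℕtoℚ t)
    F≡G t = begin
      eval F (ℕtoℚ t)                                                   ≡⟨ T-eval E F E-ehrhart F-T t ⟩
      ℕtoℚ a ℚ.* eval E (ℕtoℚ (p * t)) ℚ.+ ℕtoℚ b ℚ.* eval E (ℕtoℚ t)   ≡⟨ cong (λ x → ℕtoℚ a ℚ.* eval E x ℚ.+ ℕtoℚ b ℚ.* eval E (ℕtoℚ t)) (sym (π*t t)) ⟩
      ℕtoℚ a ℚ.* eval E (π ℚ.* ℕtoℚ t) ℚ.+ ℕtoℚ b ℚ.* eval E (ℕtoℚ t)   ≡⟨ sym (eval-·dilate+· a b p E (ℕtoℚ t)) ⟩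
      eval G (ℕtoℚ t)                                                   ∎

theorem1p1 :
    -- (1) c_l(T(p,k)E(P)) = ν_{n,k,l}(p) · c_l(E(P))
    (∀ (n m : ℕ) (vs : Vec (Vec ℤ n) m) → FullDim vs →
     ∀ (p : ℕ) .{{_ : NonZero p}} → Prime p →
     ∀ (k : ℕ) → 1 ≤ k → k < n →
     ∀ (l : ℕ) → l ≤ n →
     ∀ (U : Fpⁿ p n → Set) → HasDim p U l →
     ∀ (ν : ℕ) → NuValue p n k U ν →
     ∀ (E F : Poly) → IsEhrhart vs E → IsTpkE p k vs F →
     coeff F l ≡ ℕtoℚ ν ℚ.* coeff E l)
    ×
    -- (2) ν_{n,k,l}(p) / ν_{n,n-k,n-l}(p) = p^{k+l-n}
    (∀ (n : ℕ) (p : ℕ) .{{_ : NonZero p}} → Prime p →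
     ∀ (k : ℕ) → 1 ≤ k → k < n →
     ∀ (l : ℕ) → l ≤ n →
     ∀ (U : Fpⁿ p n → Set) → HasDim p U l →
     ∀ (U' : Fpⁿ p n → Set) → HasDim p U' (n ∸ l) →
     ∀ (ν ν' : ℕ) → NuValue p n k U ν → NuValue p n (n ∸ k) U' ν' →
     ν * p ^ n ≡ ν' * p ^ (k + l))
    ×
    -- (3) ν_{n,k,l}(p) = Φ_{n,k,l}(p) for a p-independent Φ with coefficients in ℕ
    (∀ (n k : ℕ) → 1 ≤ k → k < n → ∀ (l : ℕ) → l ≤ n →
     Σ (List ℕ) λ Φ →
       ∀ (p : ℕ) .{{_ : NonZero p}} → Prime p →
       ∀ (U : Fpⁿ p n → Set) → HasDim p U l →
       ∀ (ν : ℕ) → NuValue p n k U ν → evalℕ Φ p ≡ ν)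
theorem1p1 =
    (λ where
      (suc n′) m vs _ p p-prime (suc k′) _ _ l _ U dimU ν ν-value E F E-ehrhart F-T →
        HeckeOperator.T-coeff p p-prime n′ k′ vs l dimU ν-value E F E-ehrhart F-T)
  , (λ where
      (suc n′) p p-prime (suc k′) _ k<n l l≤n U dimU U′ dimU′ ν ν′ ν-value ν′-value →
        Subspaces.ν-duality p p-prime k<n l≤n dimU dimU′ ν-value ν′-value)
  , (λ where
      (suc n′) (suc k′) _ _ l _ → ν-polynomial n′ k′ l , λ p p-prime U dimU ν ν-value →
        trans (evalℕ-ν-polynomial p n′ k′ l) (sym (Subspaces.ν-formula p p-prime dimU ν-value)))
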